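{- Let $\Gamma$ be a graph and let $\Lambda$ and $\Sigma$ be subgraphs of $\Gamma$ (possibly with $V(\Lambda)\neq V(\Sigma)$) such that $\Gamma=\Lambda\cup\Sigma$. Suppose that $\Lambda$ admits a nowhere-zero $3$-flow, and that every connected component $\Theta$ of $\Sigma$ is a generalized closed ladder satisfying: (i) $\Theta$ admits a nowhere-zero $3$-flow if it has no common edges with $\Lambda$; and (ii) each common edge of $\Theta$ and $\Lambda$, if any, is a rung of $\Theta$. Then $\Gamma$ admits a nowhere-zero $3$-flow.
   Context: Graphs are finite, undirected and loopless, with parallel edges allowed; the union of graphs takes unions of vertex sets and of edge sets. A $k$-flow in a graph is a pair $(D,\varphi)$ where $D$ is an orientation and $\varphi$ assigns an integer to each arc with $|\varphi(e)|<k$ and with flow conservation at every vertex; it is nowhere-zero if $\varphi$ never vanishes. For $n\ge2$, the circular ladder $CL_n$ is the Cayley graph of $\mathbb{Z}_n\times\mathbb{Z}_2$ with connection set $\{(1,0),(-1,0),(0,1)\}$ (for $n=2$ with parallel edges); its rungs are the edges $\{(i,0),(i,1)\}$ and its other edges are rail edges. The Möbius ladder $M_n$ ($n\ge2$) is the Cayley graph of $\mathbb{Z}_{2n}$ with connection set $\{1,-1,n\}$; its rungs are the edges $\{i,i+n\}$ and its other edges are rail edges. A generalized circular (resp. Möbius) ladder with $n\ge2$ rungs is obtained from $CL_n$ (resp. $M_n$) by replacing each rail edge by a path of length at least one (rungs stay rungs). By convention, graphs obtained from a generalized circular ladder with two rungs by deleting one or both rungs (two disjoint cycles joined by one edge,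 or two disjoint cycles) are generalized circular ladders with one rung or zero rungs, and graphs obtained from a generalized Möbius ladder with two rungs by deleting one or both rungs (a cycle with one chord, or a cycle) are generalized Möbius ladders with one rung (the chord) or zero rungs. A generalized closed ladder is a generalized circular or Möbius ladder. -}

module Defs where

open import Data.Nat using (ℕ; zero; suc; _≤_; _<_)
open import Data.Nat.DivMod using (_mod_)
open import Data.Fin as Fin using (Fin; toℕ)
open import Data.Integer as ℤ using (ℤ; ∣_∣; _-_; 0ℤ)
open import Data.Bool using (Bool; true; false; if_then_else_; _∨_; _∧_)
open import Data.Product using (Σ; ∃; _×_; _,_; proj₁; proj₂; swap)
open import Data.Sum using (_⊎_; inj₁; inj₂)
open import Data.Unit using (⊤)
open import Data.Empty using (⊥)
open import Relation.Nullary using (¬_; does)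
open import Relation.Binary.PropositionalEquality using (_≡_; _≢_)

-- Finite loopless multigraphs: vertices Fin nV, edges Fin nE,
-- each edge has an (arbitrary reference) ordered pair of distinct ends.

record Graph : Set where
  field
    nV       : ℕ
    nE       : ℕ
    ends     : Fin nE → Fin nV × Fin nV
    loopless : ∀ e → proj₁ (ends e) ≢ proj₂ (ends e)

open Graph public

record Subgraph (Γ : Graph) : Set where
  field
    vs     : Fin (nV Γ) → Bool
    es     : Fin (nE Γ) → Bool
    closed : ∀ e → es e ≡ true →
             (vs (proj₁ (ends Γ e)) ≡ true) × (vs (proj₂ (ends Γ e)) ≡ true)

open Subgraph public

whole : (Γ : Graph) → Subgraph Γ
whole Γ = record { vs = λ _ → true ; es = λ _ → true ; closed = λ _ _ → _≡_.refl , _≡_.refl }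

IsUnion : (Γ : Graph) → Subgraph Γ → Subgraph Γ → Set
IsUnion Γ Λ Σ' = (∀ v → (vs Λ v ∨ vs Σ' v) ≡ true) × (∀ e → (es Λ e ∨ es Σ' e) ≡ true)

_⊆G_ : {Γ : Graph} → Subgraph Γ → Subgraph Γ → Set
H ⊆G K = (∀ v → vs H v ≡ true → vs K v ≡ true) × (∀ e → es H e ≡ true → es K e ≡ true)

Joins : (Γ : Graph) → Fin (nE Γ) → Fin (nV Γ) → Fin (nV Γ) → Set
Joins Γ e u w = (ends Γ e ≡ (u , w)) ⊎ (ends Γ e ≡ (w , u))

data Walk {Γ : Graph} (H : Subgraph Γ) : Fin (nV Γ) → Fin (nV Γ) → Set where
  here : ∀ {u} → Walk H u u
  step : ∀ {u w v} (e : Fin (nE Γ)) → es H e ≡ true → Joins Γ e u w →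
         Walk H w v → Walk H u v

Connected : {Γ : Graph} → Subgraph Γ → Set
Connected {Γ} H = ∀ u v → vs H u ≡ true → vs H v ≡ true → Walk H u v

-- Θ is a connected component of Σ: a nonempty connected subgraph of Σ
-- containing every edge of Σ incident with one of its vertices
-- (i.e. a maximal connected subgraph of Σ).
IsComponent : {Γ : Graph} → Subgraph Γ → Subgraph Γ → Set
IsComponent {Γ} Σ' Θ =
  (Θ ⊆G Σ') ×
  (∃ λ v → vs Θ v ≡ true) ×
  Connected Θ ×
  (∀ e → es Σ' e ≡ true →
     ((vs Θ (proj₁ (ends Γ e)) ∨ vs Θ (proj₂ (ends Γ e))) ≡ true) → es Θ e ≡ true)

∑ : ∀ {n} → (Fin n → ℤ) → ℤ
∑ {zero}  f = 0ℤ
∑ {suc n} f = f Fin.zero ℤ.+ ∑ (λ i → f (Fin.suc i))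

tailOf headOf : (Γ : Graph) → (Fin (nE Γ) → Bool) → Fin (nE Γ) → Fin (nV Γ)
tailOf Γ D e = if D e then proj₁ (ends Γ e) else proj₂ (ends Γ e)
headOf Γ D e = if D e then proj₂ (ends Γ e) else proj₁ (ends Γ e)

netAt : (Γ : Graph) → (Fin (nE Γ) → Bool) → (Fin (nE Γ) → ℤ) →
        Fin (nV Γ) → Fin (nE Γ) → ℤ
netAt Γ D φ v e =
  (if does (tailOf Γ D e Fin.≟ v) then φ e else 0ℤ) -
  (if does (headOf Γ D e Fin.≟ v) then φ e else 0ℤ)

IsFlow : {Γ : Graph} → ℕ → (H : Subgraph Γ) →
         (Fin (nE Γ) → Bool) → (Fin (nE Γ) → ℤ) → Set
IsFlow {Γ} k H D φ =
  (∀ e → es H e ≡ true → ∣ φ e ∣ < k) ×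
  (∀ v → vs H v ≡ true →
     ∑ (λ e → if es H e then netAt Γ D φ v e else 0ℤ) ≡ 0ℤ)

NowhereZero : {Γ : Graph} → (H : Subgraph Γ) → (Fin (nE Γ) → ℤ) → Set
NowhereZero H φ = ∀ e → es H e ≡ true → φ e ≢ 0ℤ

AdmitsNZFlow : {Γ : Graph} → ℕ → Subgraph Γ → Set
AdmitsNZFlow {Γ} k H =
  Σ (Fin (nE Γ) → Bool) λ D → Σ (Fin (nE Γ) → ℤ) λ φ →
    IsFlow k H D φ × NowhereZero H φ

record MGraph : Set₁ where
  field
    VM    : Set
    EM    : Set
    endsM : EM → VM × VM
    isRung : EM → Set

open MGraph public

cnext : ∀ {n} → Fin (suc n) → Fin (suc n)
cnext {n} i = suc (toℕ i) mod suc n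

StrictMono : ∀ {k m} → (Fin k → Fin m) → Set
StrictMono P = ∀ i j → toℕ i < toℕ j → toℕ (P i) < toℕ (P j)

-- Generalized circular ladder with k ≥ 2 rungs: CL_k with every rail
-- edge subdivided.  The two rails become cycles of lengths suc a and
-- suc b; rung i joins position P i of the first to position Q i of the
-- second; the rail paths between consecutive rung ends have lengths
-- P (i+1) - P i ≥ 1 (cyclically), etc.  For k = 2 some rungs may be
-- deleted (keep i = false), giving the 1- and 0-rung conventions.
record CircParams : Set where
  field
    k     : ℕ
    a b   : ℕ
    P     : Fin k → Fin (suc a)
    Q     : Fin k → Fin (suc b)
    keep  : Fin k → Bool
    2≤k   : 2 ≤ k
    monoP : StrictMono P
    monoQ : StrictMono Q
    keepOK : (k ≡ 2) ⊎ (∀ i → keep i ≡ true)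

-- Generalized Möbius ladder with k ≥ 2 rungs: M_k (Z_2k, rungs {i,i+k})
-- with every rail edge subdivided: one cycle of length suc a, with the
-- 2k rung ends at positions P 0 < … < P (k-1) < Q 0 < … < Q (k-1),
-- rung i joining P i and Q i.
record MobParams : Set where
  field
    k     : ℕ
    a     : ℕ
    P Q   : Fin k → Fin (suc a)
    keep  : Fin k → Bool
    2≤k   : 2 ≤ k
    monoP : StrictMono P
    monoQ : StrictMono Q
    P<Q   : ∀ i j → toℕ (P i) < toℕ (Q j)
    keepOK : (k ≡ 2) ⊎ (∀ i → keep i ≡ true)

circModel : CircParams → MGraph
circModel p = record
  { VM = Fin (suc a) ⊎ Fin (suc b)
  ; EM = Fin (suc a) ⊎ (Fin (suc b) ⊎ Σ (Fin k) (λ i → keep i ≡ true))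
  ; endsM = ends'
  ; isRung = rung'
  }
  where
  open CircParams p
  ends' : Fin (suc a) ⊎ (Fin (suc b) ⊎ Σ (Fin k) (λ i → keep i ≡ true)) →
          (Fin (suc a) ⊎ Fin (suc b)) × (Fin (suc a) ⊎ Fin (suc b))
  ends' (inj₁ j)               = inj₁ j , inj₁ (cnext j)
  ends' (inj₂ (inj₁ j))        = inj₂ j , inj₂ (cnext j)
  ends' (inj₂ (inj₂ (i , _)))  = inj₁ (P i) , inj₂ (Q i)
  rung' : Fin (suc a) ⊎ (Fin (suc b) ⊎ Σ (Fin k) (λ i → keep i ≡ true)) → Set
  rung' (inj₁ _)        = ⊥
  rung' (inj₂ (inj₁ _)) = ⊥
  rung' (inj₂ (inj₂ _)) = ⊤

mobModel : MobParams → MGraph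
mobModel p = record
  { VM = Fin (suc a)
  ; EM = Fin (suc a) ⊎ Σ (Fin k) (λ i → keep i ≡ true)
  ; endsM = ends'
  ; isRung = rung'
  }
  where
  open MobParams p
  ends' : Fin (suc a) ⊎ Σ (Fin k) (λ i → keep i ≡ true) → Fin (suc a) × Fin (suc a)
  ends' (inj₁ j)       = j , cnext j
  ends' (inj₂ (i , _)) = P i , Q i
  rung' : Fin (suc a) ⊎ Σ (Fin k) (λ i → keep i ≡ true) → Set
  rung' (inj₁ _) = ⊥
  rung' (inj₂ _) = ⊤

LadderParams : Set
LadderParams = CircParams ⊎ MobParams

ladderModel : LadderParams → MGraph
ladderModel (inj₁ p) = circModel p
ladderModel (inj₂ p) = mobModel p

record Iso {Γ : Graph} (M : MGraph) (Θ : Subgraph Γ) : Set where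
  field
    f      : VM M → Fin (nV Γ)
    g      : EM M → Fin (nE Γ)
    f-inj  : ∀ x y → f x ≡ f y → x ≡ y
    g-inj  : ∀ x y → g x ≡ g y → x ≡ y
    f-into : ∀ x → vs Θ (f x) ≡ true
    g-into : ∀ x → es Θ (g x) ≡ true
    f-onto : ∀ v → vs Θ v ≡ true → ∃ λ x → f x ≡ v
    g-onto : ∀ e → es Θ e ≡ true → ∃ λ x → g x ≡ e
    incid  : ∀ x → Joins Γ (g x) (f (proj₁ (endsM M x))) (f (proj₂ (endsM M x)))

open Iso public

record ClosedLadderStr {Γ : Graph} (Θ : Subgraph Γ) : Set₁ where
  field
    params : LadderParams
    iso    : Iso (ladderModel params) Θ

open ClosedLadderStr public

IsRungOf : {Γ : Graph} {Θ : Subgraph Γ} → ClosedLadderStr Θ → Fin (nE Γ) → Set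
IsRungOf L e = ∃ λ x → isRung (ladderModel (params L)) x × g (iso L) x ≡ e

CommonEdge : {Γ : Graph} → Subgraph Γ → Subgraph Γ → Fin (nE Γ) → Set
CommonEdge H K e = (es H e ∧ es K e) ≡ true

-- Orient every edge from its first to its second end; a nowhere-zero 3-flow then becomes an
-- integer circulation with values in {±1, ±2}. Let ψ be such a circulation on Λ. It suffices to
-- find, for every component Θ of Σ, a circulation φ supported on Θ such that ψ + φ takes values
-- in {±1, ±2} on Θ: these add up over the components, and the remaining edges lie in Λ.
-- If Θ shares no edge with Λ, its own flow will do. Otherwise Θ shares some rung with Λ, and no
-- rail edge. The rungs cut the rails into k segments; give the rail edges of segment l the value
-- v(s l) ∈ {1, 2} for a label s l ∈ Bool (negated on the second rail of a circular ladder, and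
-- replaced by 3 - v(s l) on the second pass along the rail of a Möbius ladder). Conservation then
-- forces rung l to carry v(s l) - v(s (l + 1)) ∈ {-1, 0, 1}, so labels that stay equal across the
-- rungs in Λ and change across the others make all these edges admissible. Going once around the
-- segments imposes one more condition; it is absorbed at a shared rung, whose value can be made
-- admissible by negating all the labels if necessary.

module Submission where

open import Defs
open import Axiom.UniquenessOfIdentityProofs using (module Decidable⇒UIP)
open import Data.Bool as Bool using (Bool; true; false; if_then_else_; not; _∧_; _∨_; _xor_)
open import Data.Bool.Properties using (not-involutive; ¬-not; xor-assoc; xor-comm; xor-same; xor-identityʳ)
open import Data.Fin as Fin using (Fin; toℕ; fromℕ; fromℕ<; inject₁; splitAt; _↑ˡ_; _↑ʳ_)
open import Data.Fin.Properties
  using (any?; toℕ-injective; toℕ-fromℕ; toℕ-fromℕ<; fromℕ<-toℕ; toℕ-inject₁; toℕ<n;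
         toℕ-↑ˡ; toℕ-↑ʳ; splitAt-↑ˡ; splitAt-↑ʳ; splitAt⁻¹-↑ˡ; splitAt⁻¹-↑ʳ)
open import Data.Fin.Subset as Subset using (Subset; Nonempty)
open import Data.Fin.Subset.Properties using (nonempty?; ∣p∣≤n; p⊂q⇒∣p∣<∣q∣)
open import Data.Integer as ℤ using (ℤ; 0ℤ; 1ℤ; -1ℤ; _+_; _-_; _*_; -_; ∣_∣)
import Data.Integer.Properties as ℤ
open import Algebra.Properties.CommutativeSemigroup ℤ.+-commutativeSemigroup using (interchange)
open import Data.List using (List; []; _∷_; _++_; map)
open import Data.List.Membership.Propositional using (_∈_; _∉_)
open import Data.List.Membership.Propositional.Properties using (∈-map⁺; ∈-++⁺ˡ; ∈-++⁺ʳ)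
open import Data.List.Relation.Unary.All as All using ([])
open import Data.List.Relation.Unary.Any using (here; there)
open import Data.List.Relation.Unary.Unique.Propositional using (Unique; []; _∷_)
import Data.List.Relation.Unary.Unique.Propositional.Properties as Unique
open import Data.Nat as ℕ using (ℕ; zero; suc; _≤_; _<_; _∸_; z≤n; s≤s)
import Data.Nat.Properties as ℕ
open import Data.Nat.DivMod using (m<n⇒m%n≡m; n%n≡0)
open import Data.Product using (Σ; ∃; _×_; _,_; proj₁; proj₂)
open import Data.Sum using (_⊎_; inj₁; inj₂; [_,_]′; swap)
open import Data.Vec using (tabulate)
open import Data.Vec.Properties using ([]=↔lookup; lookup∘tabulate; tabulate-cong)
open import Function using (_∘_; case_of_; Inverse)
open import Relation.Binary.Definitions using (tri<; tri≈; tri>)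
open import Relation.Binary.PropositionalEquality
open import Relation.Nullary using (¬_; Dec; yes; no; does; contradiction)
open import Relation.Nullary.Decidable using (¬?; _×-dec_; _⊎-dec_; dec-true; dec-false)

open Decidable⇒UIP Bool._≟_ using (≡-irrelevant)

true-or-false : ∀ b → b ≡ true ⊎ b ≡ false
true-or-false true  = inj₁ refl
true-or-false false = inj₂ refl

∧-true⁻ : ∀ {a b} → (a ∧ b) ≡ true → a ≡ true × b ≡ true
∧-true⁻ {true} b≡true = refl , b≡true

∧-true⁺ : ∀ {a b} → a ≡ true → b ≡ true → (a ∧ b) ≡ true
∧-true⁺ refl refl = refl

∨-true⁻ : ∀ {a b} → (a ∨ b) ≡ true → a ≡ true ⊎ b ≡ true
∨-true⁻ {true}  _ = inj₁ refl
∨-true⁻ {false} b = inj₂ b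

-- Sums

∑-cong : ∀ {n} {f h : Fin n → ℤ} → (∀ i → f i ≡ h i) → ∑ f ≡ ∑ h
∑-cong {zero}  eq = refl
∑-cong {suc n} eq = cong₂ _+_ (eq Fin.zero) (∑-cong (eq ∘ Fin.suc))

∑-zero : ∀ {n} {f : Fin n → ℤ} → (∀ i → f i ≡ 0ℤ) → ∑ f ≡ 0ℤ
∑-zero {zero}  eq = refl
∑-zero {suc n} eq = cong₂ _+_ (eq Fin.zero) (∑-zero (eq ∘ Fin.suc))

∑-distrib-+ : ∀ {n} (f h : Fin n → ℤ) → ∑ (λ i → f i + h i) ≡ ∑ f + ∑ h
∑-distrib-+ {zero}  f h = refl
∑-distrib-+ {suc n} f h =
  trans (cong (f Fin.zero + h Fin.zero +_) (∑-distrib-+ (f ∘ Fin.suc) (h ∘ Fin.suc)))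
        (interchange (f Fin.zero) (h Fin.zero) (∑ (f ∘ Fin.suc)) (∑ (h ∘ Fin.suc)))

∑-indicator : ∀ {n} (j : Fin n) (c : ℤ) → ∑ (λ i → if does (i Fin.≟ j) then c else 0ℤ) ≡ c
∑-indicator {suc n} Fin.zero    c = trans (cong (c +_) (∑-zero {n} (λ _ → refl))) (ℤ.+-identityʳ c)
∑-indicator {suc n} (Fin.suc j) c = trans (ℤ.+-identityˡ _) (∑-indicator j c)

∑ᴸ : {A : Set} → (A → ℤ) → List A → ℤ
∑ᴸ f []       = 0ℤ
∑ᴸ f (x ∷ xs) = f x + ∑ᴸ f xs

∑ᴸ-cong : {A : Set} {f h : A → ℤ} (xs : List A) → (∀ x → x ∈ xs → f x ≡ h x) → ∑ᴸ f xs ≡ ∑ᴸ h xs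
∑ᴸ-cong []       eq = refl
∑ᴸ-cong (x ∷ xs) eq = cong₂ _+_ (eq x (here refl)) (∑ᴸ-cong xs (λ y → eq y ∘ there))

∑ᴸ-++ : {A : Set} (f : A → ℤ) (xs ys : List A) → ∑ᴸ f (xs ++ ys) ≡ ∑ᴸ f xs + ∑ᴸ f ys
∑ᴸ-++ f []       ys = sym (ℤ.+-identityˡ (∑ᴸ f ys))
∑ᴸ-++ f (x ∷ xs) ys = trans (cong (f x +_) (∑ᴸ-++ f xs ys)) (sym (ℤ.+-assoc (f x) (∑ᴸ f xs) (∑ᴸ f ys)))

∑ᴸ-map : {A B : Set} (f : B → ℤ) (h : A → B) (xs : List A) → ∑ᴸ f (map h xs) ≡ ∑ᴸ (f ∘ h) xs
∑ᴸ-map f h []       = refl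
∑ᴸ-map f h (x ∷ xs) = cong (f (h x) +_) (∑ᴸ-map f h xs)

∑ᴸ-neg : {A : Set} (f : A → ℤ) (xs : List A) → ∑ᴸ (λ x → - f x) xs ≡ - ∑ᴸ f xs
∑ᴸ-neg f []       = refl
∑ᴸ-neg f (x ∷ xs) = trans (cong (- f x +_) (∑ᴸ-neg f xs)) (sym (ℤ.neg-distrib-+ (f x) (∑ᴸ f xs)))

∑-support : ∀ {n} (f : Fin n → ℤ) (xs : List (Fin n)) → Unique xs →
            (∀ i → i ∉ xs → f i ≡ 0ℤ) → ∑ f ≡ ∑ᴸ f xs
∑-support f []       _          outside = ∑-zero (λ i → outside i λ ())
∑-support f (x ∷ xs) (x∉xs ∷ u) outside = begin
  ∑ f                    ≡⟨ ∑-cong split ⟩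
  ∑ (λ i → at i + off i) ≡⟨ ∑-distrib-+ at off ⟩
  ∑ at + ∑ off           ≡⟨ cong₂ _+_ (∑-indicator x (f x)) (∑-support off xs u off-outside) ⟩
  f x + ∑ᴸ off xs        ≡⟨ cong (f x +_) (∑ᴸ-cong xs off-on-xs) ⟩
  f x + ∑ᴸ f xs          ∎
  where
  open ≡-Reasoning
  at off : Fin _ → ℤ
  at  i = if does (i Fin.≟ x) then f x else 0ℤ
  off i = if does (i Fin.≟ x) then 0ℤ else f i
  split : ∀ i → f i ≡ at i + off i
  split i with i Fin.≟ x
  ... | yes refl = sym (ℤ.+-identityʳ (f i))
  ... | no  _    = sym (ℤ.+-identityˡ (f i))
  off-outside : ∀ i → i ∉ xs → off i ≡ 0ℤ
  off-outside i i∉xs with i Fin.≟ x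
  ... | yes _   = refl
  ... | no  i≢x = outside i λ { (here i≡x) → i≢x i≡x ; (there i∈xs) → i∉xs i∈xs }
  off-on-xs : ∀ y → y ∈ xs → off y ≡ f y
  off-on-xs y y∈xs rewrite dec-false (y Fin.≟ x) (λ y≡x → All.lookup x∉xs y∈xs (sym y≡x)) = refl

-- Circulations, for the orientation of every edge from its first to its second end

NZ3 : ℤ → Set
NZ3 z = z ≢ 0ℤ × ∣ z ∣ < 3

NZ3-neg : ∀ {z} → NZ3 z → NZ3 (- z)
NZ3-neg {z} (z≢0 , ∣z∣<3) =
  (λ -z≡0 → z≢0 (ℤ.neg-injective -z≡0)) , subst (_< 3) (sym (ℤ.∣-i∣≡∣i∣ z)) ∣z∣<3

NZ3-+0 : ∀ {e z} → e ≡ 0ℤ → NZ3 z → NZ3 (e + z)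
NZ3-+0 {z = z} refl = subst NZ3 (sym (ℤ.+-identityˡ z))

NZ3-+0ʳ : ∀ {z e} → e ≡ 0ℤ → NZ3 z → NZ3 (z + e)
NZ3-+0ʳ {z} refl = subst NZ3 (sym (ℤ.+-identityʳ z))

forward : ∀ {n} → Fin n → Bool
forward _ = true

𝟙 : Bool → ℤ
𝟙 b = if b then 1ℤ else 0ℤ

isTail isHead : (Γ : Graph) → Fin (nE Γ) → Fin (nV Γ) → Bool
isTail Γ e v = does (proj₁ (ends Γ e) Fin.≟ v)
isHead Γ e v = does (proj₂ (ends Γ e) Fin.≟ v)

incidence : (Γ : Graph) → Fin (nV Γ) → Fin (nE Γ) → ℤ
incidence Γ v e = 𝟙 (isTail Γ e v) - 𝟙 (isHead Γ e v)

outflow : (Γ : Graph) → (Fin (nE Γ) → ℤ) → Fin (nV Γ) → ℤ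
outflow Γ φ v = ∑ (λ e → incidence Γ v e * φ e)

IsCirculation : (Γ : Graph) → (Fin (nE Γ) → ℤ) → Set
IsCirculation Γ φ = ∀ v → outflow Γ φ v ≡ 0ℤ

SupportedOn : {Γ : Graph} → Subgraph Γ → (Fin (nE Γ) → ℤ) → Set
SupportedOn H φ = ∀ e → es H e ≡ false → φ e ≡ 0ℤ

Incident : (Γ : Graph) → Fin (nV Γ) → Fin (nE Γ) → Set
Incident Γ v e = proj₁ (ends Γ e) ≡ v ⊎ proj₂ (ends Γ e) ≡ v

reorient : ∀ {n} → (Fin n → Bool) → (Fin n → ℤ) → Fin n → ℤ
reorient D φ e = if D e then φ e else - φ e

if-difference : ∀ b c z → (if b then z else 0ℤ) - (if c then z else 0ℤ) ≡ (𝟙 b - 𝟙 c) * z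
if-difference true  true  z = ℤ.+-inverseʳ z
if-difference true  false z = trans (ℤ.+-identityʳ z) (sym (ℤ.*-identityˡ z))
if-difference false true  z = trans (ℤ.+-identityˡ (- z)) (sym (ℤ.-1*i≡-i z))
if-difference false false z = refl

if-difference-swapped : ∀ b c z → (if c then z else 0ℤ) - (if b then z else 0ℤ) ≡ (𝟙 b - 𝟙 c) * - z
if-difference-swapped b c z = trans (if-difference c b z) (swapped b c)
  where
  swapped : ∀ b c → (𝟙 c - 𝟙 b) * z ≡ (𝟙 b - 𝟙 c) * - z
  swapped true  true  = refl
  swapped true  false = trans (ℤ.-1*i≡-i z) (sym (ℤ.*-identityˡ (- z)))
  swapped false true  = trans (ℤ.*-identityˡ z) (sym (trans (ℤ.-1*i≡-i (- z)) (ℤ.neg-involutive z)))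
  swapped false false = refl

netAt≡incidence*reorient : ∀ Γ (D : Fin (nE Γ) → Bool) (φ : Fin (nE Γ) → ℤ) v e →
  netAt Γ D φ v e ≡ incidence Γ v e * reorient D φ e
netAt≡incidence*reorient Γ D φ v e with D e
... | true  = if-difference (isTail Γ e v) (isHead Γ e v) (φ e)
... | false = if-difference-swapped (isTail Γ e v) (isHead Γ e v) (φ e)

incidence-nonincident : ∀ Γ {v e} → ¬ Incident Γ v e → incidence Γ v e ≡ 0ℤ
incidence-nonincident Γ {v} {e} ¬inc
  rewrite dec-false (proj₁ (ends Γ e) Fin.≟ v) (¬inc ∘ inj₁)
        | dec-false (proj₂ (ends Γ e) Fin.≟ v) (¬inc ∘ inj₂) = refl

ends-distinct : ∀ Γ {e u w} → ends Γ e ≡ (u , w) → u ≢ w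
ends-distinct Γ {e} eq = subst (λ p → proj₁ p ≢ proj₂ p) eq (loopless Γ e)

incidence-tail : ∀ Γ {e u w} → ends Γ e ≡ (u , w) → incidence Γ u e ≡ 1ℤ
incidence-tail Γ {e} {u} {w} eq
  rewrite eq | dec-true (u Fin.≟ u) refl | dec-false (w Fin.≟ u) (ends-distinct Γ eq ∘ sym) = refl

incidence-head : ∀ Γ {e u w} → ends Γ e ≡ (u , w) → incidence Γ w e ≡ -1ℤ
incidence-head Γ {e} {u} {w} eq
  rewrite eq | dec-true (w Fin.≟ w) refl | dec-false (u Fin.≟ w) (ends-distinct Γ eq) = refl

incident? : ∀ Γ v e → Dec (Incident Γ v e)
incident? Γ v e = (proj₁ (ends Γ e) Fin.≟ v) ⊎-dec (proj₂ (ends Γ e) Fin.≟ v)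

outflow-local : ∀ Γ {φ χ v} → (∀ e → Incident Γ v e → φ e ≡ χ e) → outflow Γ φ v ≡ outflow Γ χ v
outflow-local Γ {φ} {χ} {v} agree = ∑-cong pointwise
  where
  pointwise : ∀ e → incidence Γ v e * φ e ≡ incidence Γ v e * χ e
  pointwise e with incident? Γ v e
  ... | yes inc  = cong (incidence Γ v e *_) (agree e inc)
  ... | no  ¬inc rewrite incidence-nonincident Γ ¬inc = refl

outflow-zero : ∀ Γ v → outflow Γ (λ _ → 0ℤ) v ≡ 0ℤ
outflow-zero Γ v = ∑-zero (λ e → ℤ.*-zeroʳ (incidence Γ v e))

outflow-outside : ∀ Γ (H : Subgraph Γ) {φ v} → SupportedOn H φ → vs H v ≡ false → outflow Γ φ v ≡ 0ℤ
outflow-outside Γ H {φ} {v} supported v∉H = trans (outflow-local Γ vanishes) (outflow-zero Γ v)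
  where
  vanishes : ∀ e → Incident Γ v e → φ e ≡ 0ℤ
  vanishes e inc with es H e in e∈H
  ... | false = supported e e∈H
  ... | true with inc | closed H e e∈H
  ...   | inj₁ refl | p₁∈H , _ with () ← trans (sym p₁∈H) v∉H
  ...   | inj₂ refl | _ , p₂∈H with () ← trans (sym p₂∈H) v∉H

circulation-+ : ∀ Γ {φ χ} → IsCirculation Γ φ → IsCirculation Γ χ → IsCirculation Γ (λ e → φ e + χ e)
circulation-+ Γ {φ} {χ} φ-circulation χ-circulation v = begin
  ∑ (λ e → incidence Γ v e * (φ e + χ e)) ≡⟨ ∑-cong (λ e → ℤ.*-distribˡ-+ (incidence Γ v e) _ _) ⟩
  ∑ (λ e → Bφ e + Bχ e)                   ≡⟨ ∑-distrib-+ Bφ Bχ ⟩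
  outflow Γ φ v + outflow Γ χ v           ≡⟨ cong₂ _+_ (φ-circulation v) (χ-circulation v) ⟩
  0ℤ                                      ∎
  where
  open ≡-Reasoning
  Bφ Bχ : Fin (nE Γ) → ℤ
  Bφ e = incidence Γ v e * φ e
  Bχ e = incidence Γ v e * χ e

circulation-of-flow : ∀ {Γ} (H : Subgraph Γ) → AdmitsNZFlow 3 H →
  Σ (Fin (nE Γ) → ℤ) λ φ → IsCirculation Γ φ × SupportedOn H φ × (∀ e → es H e ≡ true → NZ3 (φ e))
circulation-of-flow {Γ} H (D , φ , (bounded , conserved) , nonzero) = φ̂ , circulation , supported , values
  where
  φ̂ : Fin (nE Γ) → ℤ
  φ̂ e = if es H e then reorient D φ e else 0ℤ
  supported : SupportedOn H φ̂
  supported e e∉H rewrite e∉H = refl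
  values : ∀ e → es H e ≡ true → NZ3 (φ̂ e)
  values e e∈H rewrite e∈H with D e
  ... | true  = nonzero e e∈H , bounded e e∈H
  ... | false = NZ3-neg (nonzero e e∈H , bounded e e∈H)
  on-H : ∀ v e → incidence Γ v e * φ̂ e ≡ (if es H e then netAt Γ D φ v e else 0ℤ)
  on-H v e with es H e
  ... | true  = sym (netAt≡incidence*reorient Γ D φ v e)
  ... | false = ℤ.*-zeroʳ (incidence Γ v e)
  circulation : IsCirculation Γ φ̂
  circulation v with vs H v in v∈H
  ... | true  = trans (∑-cong (on-H v)) (conserved v v∈H)
  ... | false = outflow-outside Γ H supported v∈H

flow-of-circulation : ∀ Γ {h} → IsCirculation Γ h → (∀ e → NZ3 (h e)) → AdmitsNZFlow 3 (whole Γ)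
flow-of-circulation Γ {h} circulation values =
  forward , h , ((λ e _ → proj₂ (values e)) , conserved) , (λ e _ → proj₁ (values e))
  where
  conserved : ∀ v → true ≡ true → ∑ (netAt Γ forward h v) ≡ 0ℤ
  conserved v _ = trans (∑-cong (netAt≡incidence*reorient Γ forward h v)) (circulation v)

Corrects : ∀ {Γ} → (Fin (nE Γ) → ℤ) → Subgraph Γ → (Fin (nE Γ) → ℤ) → Set
Corrects {Γ} ψ Θ φ = IsCirculation Γ φ × SupportedOn Θ φ × (∀ e → es Θ e ≡ true → NZ3 (ψ e + φ e))

-- Components

_++ʷ_ : ∀ {Γ} {H : Subgraph Γ} {u w v} → Walk H u w → Walk H w v → Walk H u v
here         ++ʷ q = q
step e p j r ++ʷ q = step e p j (r ++ʷ q)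

Joins-sym : ∀ {Γ} {e : Fin (nE Γ)} {u w} → Joins Γ e u w → Joins Γ e w u
Joins-sym (inj₁ eq) = inj₂ eq
Joins-sym (inj₂ eq) = inj₁ eq

reverseʷ : ∀ {Γ} {H : Subgraph Γ} {u v} → Walk H u v → Walk H v u
reverseʷ         here           = here
reverseʷ {Γ} (step e p j r) = reverseʷ r ++ʷ step e p (Joins-sym {Γ} {e} j) here

walk-stays : ∀ {Γ} {H : Subgraph Γ} {u v} → vs H u ≡ true → Walk H u v → vs H v ≡ true
walk-stays u∈H here = u∈H
walk-stays {H = H} u∈H (step e e∈H (inj₁ refl) r) = walk-stays (proj₂ (closed H e e∈H)) r
walk-stays {H = H} u∈H (step e e∈H (inj₂ refl) r) = walk-stays (proj₁ (closed H e e∈H)) r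

∈-tabulate⁺ : ∀ {n} {t : Fin n → Bool} {v} → t v ≡ true → v Subset.∈ tabulate t
∈-tabulate⁺ {t = t} {v} tv = Inverse.from []=↔lookup (trans (lookup∘tabulate t v) tv)

∈-tabulate⁻ : ∀ {n} {t : Fin n → Bool} {v} → v Subset.∈ tabulate t → t v ≡ true
∈-tabulate⁻ {t = t} {v} v∈t = trans (sym (lookup∘tabulate t v)) (Inverse.to []=↔lookup v∈t)

choose : ∀ {n} → Subset n → Fin n → Fin n
choose p d with nonempty? p
... | yes (v , _) = v
... | no  _       = d

choose-∈ : ∀ {n} {p : Subset n} d → Nonempty p → choose p d Subset.∈ p
choose-∈ {p = p} d ne with nonempty? p
... | yes (_ , v∈p) = v∈p
... | no  ¬ne       = contradiction ne ¬ne

choose-default : ∀ {n} {p : Subset n} d d' → Nonempty p → choose p d ≡ choose p d'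
choose-default {p = p} d d' ne with nonempty? p
... | yes _  = refl
... | no ¬ne = contradiction ne ¬ne

module Reachability {Γ : Graph} (S : Subgraph Γ) where

  private
    n : ℕ
    n = nV Γ
    p₁ p₂ : Fin (nE Γ) → Fin n
    p₁ e = proj₁ (ends Γ e)
    p₂ e = proj₂ (ends Γ e)

  VertexSet : Set
  VertexSet = Fin n → Bool

  Enters : VertexSet → Fin n → Fin (nE Γ) → Set
  Enters t v e = es S e ≡ true × (t (p₁ e) ≡ true × p₂ e ≡ v ⊎ t (p₂ e) ≡ true × p₁ e ≡ v)

  enters? : ∀ t v e → Dec (Enters t v e)
  enters? t v e = (es S e Bool.≟ true) ×-dec
    ((t (p₁ e) Bool.≟ true ×-dec p₂ e Fin.≟ v) ⊎-dec (t (p₂ e) Bool.≟ true ×-dec p₁ e Fin.≟ v))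

  grow : VertexSet → VertexSet
  grow t v = t v ∨ does (any? (enters? t v))

  grow^ : ℕ → VertexSet → VertexSet
  grow^ zero    t = t
  grow^ (suc m) t = grow (grow^ m t)

  Closed : VertexSet → Set
  Closed t = ∀ v e → Enters t v e → t v ≡ true

  grow-⊇ : ∀ t {v} → t v ≡ true → grow t v ≡ true
  grow-⊇ t tv rewrite tv = refl

  grow-entered : ∀ t {v e} → Enters t v e → grow t v ≡ true
  grow-entered t {v} {e} entry rewrite dec-true (any? (enters? t v)) (e , entry) with t v
  ... | true  = refl
  ... | false = refl

  grow-sound : ∀ t {v} → grow t v ≡ true → t v ≡ true ⊎ ∃ (Enters t v)
  grow-sound t {v} _ with t v | any? (enters? t v)
  ... | true  | _         = inj₁ refl
  ... | false | yes entry = inj₂ entry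

  grow-closed : ∀ {t} → Closed t → ∀ v → grow t v ≡ t v
  grow-closed {t} c v with t v in tv | any? (enters? t v)
  ... | true  | _               = refl
  ... | false | no  _           = refl
  ... | false | yes (e , entry) with () ← trans (sym tv) (c v e entry)

  closed? : ∀ t → Closed t ⊎ ∃ λ v → t v ≡ false × ∃ (Enters t v)
  closed? t with any? (λ v → (t v Bool.≟ false) ×-dec any? (enters? t v))
  ... | yes fresh = inj₂ fresh
  ... | no  ¬fresh = inj₁ λ v e entry → ¬-not (λ tv≡false → ¬fresh (v , tv≡false , e , entry))

  Closed-cong : ∀ {t t'} → (∀ v → t v ≡ t' v) → Closed t → Closed t'
  Closed-cong t≗t' c v e (e∈S , inj₁ (t'p₁ , p₂≡v)) =
    trans (sym (t≗t' v)) (c v e (e∈S , inj₁ (trans (t≗t' (p₁ e)) t'p₁ , p₂≡v)))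
  Closed-cong t≗t' c v e (e∈S , inj₂ (t'p₂ , p₁≡v)) =
    trans (sym (t≗t' v)) (c v e (e∈S , inj₂ (trans (t≗t' (p₂ e)) t'p₂ , p₁≡v)))

  size : VertexSet → ℕ
  size t = Subset.∣ tabulate t ∣

  grow-size : ∀ t {v e} → t v ≡ false → Enters t v e → size t < size (grow t)
  grow-size t {v} fresh entry = p⊂q⇒∣p∣<∣q∣
    ( (λ x∈t → ∈-tabulate⁺ (grow-⊇ t (∈-tabulate⁻ x∈t)))
    , v , ∈-tabulate⁺ (grow-entered t entry)
    , λ v∈t → contradiction (trans (sym (∈-tabulate⁻ v∈t)) fresh) λ ())

  grow^-closed-or-large : ∀ m t → Closed (grow^ m t) ⊎ m ≤ size (grow^ m t)
  grow^-closed-or-large zero    t = inj₂ z≤n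
  grow^-closed-or-large (suc m) t with closed? (grow^ m t)
  ... | inj₁ c = inj₁ (Closed-cong (λ v → sym (grow-closed c v)) c)
  ... | inj₂ (v , fresh , e , entry) with grow^-closed-or-large m t
  ...   | inj₁ c  with () ← trans (sym fresh) (c v e entry)
  ...   | inj₂ m≤ = inj₂ (ℕ.≤-<-trans m≤ (grow-size (grow^ m t) fresh entry))

  fixpoint : VertexSet → VertexSet
  fixpoint = grow^ (suc n)

  fixpoint-closed : ∀ t → Closed (fixpoint t)
  fixpoint-closed t with grow^-closed-or-large (suc n) t
  ... | inj₁ c     = c
  ... | inj₂ large = contradiction (ℕ.≤-trans large (∣p∣≤n (tabulate (fixpoint t)))) (ℕ.<-irrefl refl)

  fixpoint-⊇ : ∀ t {v} → t v ≡ true → fixpoint t v ≡ true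
  fixpoint-⊇ t {v} tv = ⊇ (suc n)
    where
    ⊇ : ∀ m → grow^ m t v ≡ true
    ⊇ zero    = tv
    ⊇ (suc m) = grow-⊇ (grow^ m t) (⊇ m)

  closed-walk : ∀ {t} → Closed t → ∀ {u v} → t u ≡ true → Walk S u v → t v ≡ true
  closed-walk c tu here = tu
  closed-walk c tu (step e e∈S (inj₁ refl) r) = closed-walk c (c _ e (e∈S , inj₁ (tu , refl))) r
  closed-walk c tu (step e e∈S (inj₂ refl) r) = closed-walk c (c _ e (e∈S , inj₂ (tu , refl))) r

  reach : Fin n → VertexSet
  reach u = fixpoint (λ v → does (u Fin.≟ v))

  reach-refl : ∀ u → reach u u ≡ true
  reach-refl u = fixpoint-⊇ _ (dec-true (u Fin.≟ u) refl)

  walk⇒reach : ∀ {u v} → Walk S u v → reach u v ≡ true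
  walk⇒reach {u} = closed-walk (fixpoint-closed _) (reach-refl u)

  reach⇒walk : ∀ u {v} → reach u v ≡ true → Walk S u v
  reach⇒walk u = grown (suc n)
    where
    grown : ∀ m {v} → grow^ m (λ w → does (u Fin.≟ w)) v ≡ true → Walk S u v
    grown zero {v} r with u Fin.≟ v
    ... | yes refl = here
    grown (suc m) r with grow-sound _ r
    ... | inj₁ r' = grown m r'
    ... | inj₂ (e , e∈S , inj₁ (r' , refl)) = grown m r' ++ʷ step e e∈S (inj₁ refl) here
    ... | inj₂ (e , e∈S , inj₂ (r' , refl)) = grown m r' ++ʷ step e e∈S (inj₂ refl) here

  reach-step : ∀ r {u w} e → es S e ≡ true → Joins Γ e u w → reach r u ≡ true → reach r w ≡ true
  reach-step r e e∈S j ru = closed-walk (fixpoint-closed _) ru (step e e∈S j here)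

  component : Fin n → Subgraph Γ
  component r = record
    { vs     = reach r
    ; es     = λ e → es S e ∧ reach r (p₁ e)
    ; closed = ends-reached
    }
    where
    ends-reached : ∀ e → (es S e ∧ reach r (p₁ e)) ≡ true →
                   (reach r (p₁ e) ≡ true) × (reach r (p₂ e) ≡ true)
    ends-reached e e∈C with es S e in e∈S
    ... | true = e∈C , reach-step r e e∈S (inj₁ refl) e∈C

  walk-in-component : ∀ {r u v} → reach r u ≡ true → Walk S u v → Walk (component r) u v
  walk-in-component ru here = here
  walk-in-component {r} ru (step e e∈S (inj₁ refl) w) =
    step e (∧-true⁺ e∈S ru) (inj₁ refl) (walk-in-component (reach-step r e e∈S (inj₁ refl) ru) w)
  walk-in-component {r} ru (step e e∈S (inj₂ refl) w) =
    step e (∧-true⁺ e∈S r-next) (inj₂ refl) (walk-in-component r-next w)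
    where
    r-next : reach r (p₁ e) ≡ true
    r-next = reach-step r e e∈S (inj₂ refl) ru

  component-isComponent : ∀ r → vs S r ≡ true → IsComponent S (component r)
  component-isComponent r r∈S =
    ((λ v rv → walk-stays r∈S (reach⇒walk r rv)) , (λ e e∈C → proj₁ (∧-true⁻ e∈C))) ,
    (r , reach-refl r) ,
    (λ u v ru rv → walk-in-component {r} ru (reverseʷ (reach⇒walk r ru) ++ʷ reach⇒walk r rv)) ,
    maximal
    where
    maximal : ∀ e → es S e ≡ true → (reach r (p₁ e) ∨ reach r (p₂ e)) ≡ true →
              (es S e ∧ reach r (p₁ e)) ≡ true
    maximal e e∈S reached with ∨-true⁻ reached
    ... | inj₁ rp₁ = ∧-true⁺ e∈S rp₁
    ... | inj₂ rp₂ = ∧-true⁺ e∈S (reach-step r e e∈S (inj₂ refl) rp₂)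

  -- Choosing from the vector tabulate (reach v) makes the representative depend on the values of reach v only.
  representative : Fin n → Fin n
  representative v = choose (tabulate (reach v)) v

  reach-representative : ∀ v → reach v (representative v) ≡ true
  reach-representative v = ∈-tabulate⁻ {t = reach v} (choose-∈ v (v , ∈-tabulate⁺ {t = reach v} (reach-refl v)))

  representative-∈ : ∀ {v} → vs S v ≡ true → vs S (representative v) ≡ true
  representative-∈ {v} v∈S = walk-stays v∈S (reach⇒walk v (reach-representative v))

  ∈-own-component : ∀ v → vs (component (representative v)) v ≡ true
  ∈-own-component v = walk⇒reach (reverseʷ (reach⇒walk v (reach-representative v)))

  representative-walk : ∀ {u w} → Walk S u w → representative u ≡ representative w
  representative-walk {u} {w} u⇝w = begin
    choose (tabulate (reach u)) u ≡⟨ cong (λ p → choose p u) (tabulate-cong same-reach) ⟩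
    choose (tabulate (reach w)) u ≡⟨ choose-default u w (w , ∈-tabulate⁺ {t = reach w} (reach-refl w)) ⟩
    choose (tabulate (reach w)) w ∎
    where
    open ≡-Reasoning
    same-truth : ∀ {a b} → (a ≡ true → b ≡ true) → (b ≡ true → a ≡ true) → a ≡ b
    same-truth {true}          a→b _   = sym (a→b refl)
    same-truth {false} {false} _   _   = refl
    same-truth {false} {true}  _   b→a = b→a refl
    same-reach : ∀ x → reach u x ≡ reach w x
    same-reach x = same-truth (λ ux → walk⇒reach (reverseʷ u⇝w ++ʷ reach⇒walk u ux))
                              (λ wx → walk⇒reach (u⇝w ++ʷ reach⇒walk w wx))

  ∈-component-representative : ∀ {e} → es S e ≡ true → es (component (representative (p₁ e))) e ≡ true
  ∈-component-representative {e} e∈S = ∧-true⁺ e∈S (∈-own-component (p₁ e))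

  representative-incident : ∀ {e v} → es S e ≡ true → Incident Γ v e → representative (p₁ e) ≡ representative v
  representative-incident e∈S (inj₁ refl) = refl
  representative-incident {e} e∈S (inj₂ refl) = representative-walk (step e e∈S (inj₁ refl) here)

  component-corrections : ∀ {ψ} → (∀ r → vs S r ≡ true → Σ (Fin (nE Γ) → ℤ) (Corrects ψ (component r))) →
                          Σ (Fin (nE Γ) → ℤ) (Corrects ψ S)
  component-corrections {ψ} corrections = glued , circulation , supported , values
    where
    Φ : Fin n → Fin (nE Γ) → ℤ
    Φ r with vs S r Bool.≟ true
    ... | yes r∈S = proj₁ (corrections r r∈S)
    ... | no  _   = λ _ → 0ℤ

    Φ-corrects : ∀ r → vs S r ≡ true → Corrects ψ (component r) (Φ r)
    Φ-corrects r r∈S with vs S r Bool.≟ true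
    ... | yes r∈S' = proj₂ (corrections r r∈S')
    ... | no  r∉S  = contradiction r∈S r∉S

    glued : Fin (nE Γ) → ℤ
    glued e = if es S e then Φ (representative (p₁ e)) e else 0ℤ

    supported : SupportedOn S glued
    supported e e∉S rewrite e∉S = refl

    circulation : IsCirculation Γ glued
    circulation v with vs S v in v∈S
    ... | false = outflow-outside Γ S supported v∈S
    ... | true  = trans (outflow-local Γ agree) (proj₁ (Φ-corrects r r∈S) v)
      where
      r : Fin n
      r = representative v
      r∈S : vs S r ≡ true
      r∈S = representative-∈ v∈S
      agree : ∀ e → Incident Γ v e → glued e ≡ Φ r e
      agree e inc with es S e in e∈S
      ... | true  = cong (λ r' → Φ r' e) (representative-incident e∈S inc)
      ... | false = sym (proj₁ (proj₂ (Φ-corrects r r∈S)) e (cong (_∧ reach r (p₁ e)) e∈S))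

    values : ∀ e → es S e ≡ true → NZ3 (ψ e + glued e)
    values e e∈S rewrite e∈S = proj₂ (proj₂ (Φ-corrects _ r∈S)) e (∈-component-representative e∈S)
      where
      r∈S : vs S (representative (p₁ e)) ≡ true
      r∈S = representative-∈ (proj₁ (closed S e e∈S))

-- Model graphs

Lists : {A : Set} → (A → Set) → List A → Set
Lists P xs = Unique xs × (∀ {x} → x ∈ xs → P x) × (∀ {x} → P x → x ∈ xs)

Leaving Entering : (M : MGraph) → VM M → EM M → Set
Leaving  M y x = proj₁ (endsM M x) ≡ y
Entering M y x = proj₂ (endsM M x) ≡ y

BalancedAt : (M : MGraph) → (EM M → ℤ) → VM M → Set
BalancedAt M h y = Σ (List (EM M)) λ outs → Σ (List (EM M)) λ ins →
  Lists (Leaving M y) outs × Lists (Entering M y) ins × ∑ᴸ h outs ≡ ∑ᴸ h ins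

IsBalanced : (M : MGraph) → (EM M → ℤ) → Set
IsBalanced M h = ∀ y → BalancedAt M h y

module Transfer {Γ : Graph} {M : MGraph} {Θ : Subgraph Γ} (I : Iso M Θ) where

  -- whether the image of the model edge x runs along or against the orientation of Γ
  sign : EM M → ℤ → ℤ
  sign x with incid I x
  ... | inj₁ _ = λ z → z
  ... | inj₂ _ = -_

  sign-involutive : ∀ x z → sign x (sign x z) ≡ z
  sign-involutive x z with incid I x
  ... | inj₁ _ = refl
  ... | inj₂ _ = ℤ.neg-involutive z

  sign-+ : ∀ x a b → sign x (a + b) ≡ sign x a + sign x b
  sign-+ x a b with incid I x
  ... | inj₁ _ = refl
  ... | inj₂ _ = ℤ.neg-distrib-+ a b

  sign-zero : ∀ x → sign x 0ℤ ≡ 0ℤ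
  sign-zero x with incid I x
  ... | inj₁ _ = refl
  ... | inj₂ _ = refl

  sign-NZ3 : ∀ x {z} → NZ3 z → NZ3 (sign x z)
  sign-NZ3 x nz3 with incid I x
  ... | inj₁ _ = nz3
  ... | inj₂ _ = NZ3-neg nz3

  transport : (EM M → ℤ) → Fin (nE Γ) → ℤ
  transport h e with es Θ e Bool.≟ true
  ... | yes e∈Θ = let x = proj₁ (g-onto I e e∈Θ) in sign x (h x)
  ... | no  _   = 0ℤ

  transport-supported : ∀ h → SupportedOn Θ (transport h)
  transport-supported h e e∉Θ with es Θ e Bool.≟ true
  ... | yes e∈Θ = contradiction (trans (sym e∈Θ) e∉Θ) λ ()
  ... | no  _   = refl

  transport-g : ∀ h x → transport h (g I x) ≡ sign x (h x)
  transport-g h x with es Θ (g I x) Bool.≟ true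
  ... | no  gx∉Θ = contradiction (g-into I x) gx∉Θ
  ... | yes gx∈Θ with g-onto I (g I x) gx∈Θ
  ...   | x' , gx'≡gx with g-inj I x' x gx'≡gx
  ...     | refl = refl

  incidence-leaving : ∀ x {y} → Leaving M y x → ∀ z → incidence Γ (f I y) (g I x) * sign x z ≡ z
  incidence-leaving x refl z with incid I x
  ... | inj₁ eq = trans (cong (_* z) (incidence-tail Γ eq)) (ℤ.*-identityˡ z)
  ... | inj₂ eq = trans (cong (_* - z) (incidence-head Γ eq)) (trans (ℤ.-1*i≡-i (- z)) (ℤ.neg-involutive z))

  incidence-entering : ∀ x {y} → Entering M y x → ∀ z → incidence Γ (f I y) (g I x) * sign x z ≡ - z
  incidence-entering x refl z with incid I x
  ... | inj₁ eq = trans (cong (_* z) (incidence-head Γ eq)) (ℤ.-1*i≡-i z)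
  ... | inj₂ eq = trans (cong (_* - z) (incidence-tail Γ eq)) (ℤ.*-identityˡ (- z))

  model-incident : ∀ x {y} → Incident Γ (f I y) (g I x) → Leaving M y x ⊎ Entering M y x
  model-incident x inc with incid I x | inc
  ... | inj₁ eq | inj₁ p = inj₁ (f-inj I _ _ (trans (cong proj₁ (sym eq)) p))
  ... | inj₁ eq | inj₂ p = inj₂ (f-inj I _ _ (trans (cong proj₂ (sym eq)) p))
  ... | inj₂ eq | inj₁ p = inj₂ (f-inj I _ _ (trans (cong proj₁ (sym eq)) p))
  ... | inj₂ eq | inj₂ p = inj₁ (f-inj I _ _ (trans (cong proj₂ (sym eq)) p))

  model-loopless : ∀ x → proj₁ (endsM M x) ≢ proj₂ (endsM M x)
  model-loopless x a≡b with incid I x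
  ... | inj₁ eq = ends-distinct Γ eq (cong (f I) a≡b)
  ... | inj₂ eq = ends-distinct Γ eq (cong (f I) (sym a≡b))

  outflow-transport : ∀ h y {outs ins} → Lists (Leaving M y) outs → Lists (Entering M y) ins →
                      outflow Γ (transport h) (f I y) ≡ ∑ᴸ h outs - ∑ᴸ h ins
  outflow-transport h y {outs} {ins} (unique-outs , outs-leave , leaving-outs) (unique-ins , ins-enter , entering-ins) =
    begin
      outflow Γ (transport h) (f I y)      ≡⟨ ∑-support F (map (g I) (outs ++ ins)) unique vanishes ⟩
      ∑ᴸ F (map (g I) (outs ++ ins))        ≡⟨ ∑ᴸ-map F (g I) (outs ++ ins) ⟩
      ∑ᴸ (F ∘ g I) (outs ++ ins)            ≡⟨ ∑ᴸ-++ (F ∘ g I) outs ins ⟩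
      ∑ᴸ (F ∘ g I) outs + ∑ᴸ (F ∘ g I) ins  ≡⟨ cong₂ _+_ (∑ᴸ-cong outs on-outs) (∑ᴸ-cong ins on-ins) ⟩
      ∑ᴸ h outs + ∑ᴸ (λ x → - h x) ins      ≡⟨ cong (∑ᴸ h outs +_) (∑ᴸ-neg h ins) ⟩
      ∑ᴸ h outs - ∑ᴸ h ins                  ∎
    where
    open ≡-Reasoning
    F : Fin (nE Γ) → ℤ
    F e = incidence Γ (f I y) e * transport h e
    on-outs : ∀ x → x ∈ outs → F (g I x) ≡ h x
    on-outs x x∈outs = trans (cong (incidence Γ (f I y) (g I x) *_) (transport-g h x))
                             (incidence-leaving x (outs-leave x∈outs) (h x))
    on-ins : ∀ x → x ∈ ins → F (g I x) ≡ - h x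
    on-ins x x∈ins = trans (cong (incidence Γ (f I y) (g I x) *_) (transport-g h x))
                           (incidence-entering x (ins-enter x∈ins) (h x))
    unique : Unique (map (g I) (outs ++ ins))
    unique = Unique.map⁺ (g-inj I _ _) (Unique.++⁺ unique-outs unique-ins
      λ (x∈outs , x∈ins) → model-loopless _ (trans (outs-leave x∈outs) (sym (ins-enter x∈ins))))
    vanishes : ∀ e → e ∉ map (g I) (outs ++ ins) → F e ≡ 0ℤ
    vanishes e e∉ with true-or-false (es Θ e)
    ... | inj₂ e∉Θ = trans (cong (incidence Γ (f I y) e *_) (transport-supported h e e∉Θ))
                           (ℤ.*-zeroʳ (incidence Γ (f I y) e))
    ... | inj₁ e∈Θ with g-onto I e e∈Θ
    ...   | x , refl = trans (cong (_* transport h (g I x)) (incidence-nonincident Γ not-incident))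
                             (ℤ.*-zeroˡ (transport h (g I x)))
      where
      not-incident : ¬ Incident Γ (f I y) (g I x)
      not-incident inc with model-incident x inc
      ... | inj₁ leaves = e∉ (∈-map⁺ (g I) (∈-++⁺ˡ (leaving-outs leaves)))
      ... | inj₂ enters = e∉ (∈-map⁺ (g I) (∈-++⁺ʳ outs (entering-ins enters)))

  transport-circulation : ∀ h → IsBalanced M h → IsCirculation Γ (transport h)
  transport-circulation h balanced v with vs Θ v in v∈Θ
  ... | false = outflow-outside Γ Θ (transport-supported h) v∈Θ
  ... | true with f-onto I v v∈Θ
  ...   | y , refl with balanced y
  ...     | outs , ins , outs-lists , ins-lists , balance =
    trans (outflow-transport h y outs-lists ins-lists)
          (trans (cong (_- ∑ᴸ h ins) balance) (ℤ.+-inverseʳ (∑ᴸ h ins)))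

  transport-corrects : ∀ ψ h → IsBalanced M h → (∀ x → NZ3 (sign x (ψ (g I x)) + h x)) →
                       Corrects ψ Θ (transport h)
  transport-corrects ψ h balanced nz3 = transport-circulation h balanced , transport-supported h , values
    where
    values : ∀ e → es Θ e ≡ true → NZ3 (ψ e + transport h e)
    values e e∈Θ with g-onto I e e∈Θ
    ... | x , refl = subst NZ3 (begin
      sign x (sign x (ψ (g I x)) + h x)          ≡⟨ sign-+ x _ (h x) ⟩
      sign x (sign x (ψ (g I x))) + sign x (h x) ≡⟨ cong (_+ sign x (h x)) (sign-involutive x _) ⟩
      ψ (g I x) + sign x (h x)                   ≡⟨ cong (ψ (g I x) +_) (transport-g h x) ⟨
      ψ (g I x) + transport h (g I x)            ∎) (sign-NZ3 x (nz3 x))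
      where open ≡-Reasoning

-- Ladders

cprev : ∀ {a} → Fin (suc a) → Fin (suc a)
cprev {a} Fin.zero    = fromℕ a
cprev     (Fin.suc i) = inject₁ i

toℕ-cnext : ∀ {a} (j : Fin (suc a)) → toℕ (cnext j) ≡ suc (toℕ j) ℕ.% suc a
toℕ-cnext j = toℕ-fromℕ< _

cnext-cprev : ∀ {a} (j : Fin (suc a)) → cnext (cprev j) ≡ j
cnext-cprev {a} Fin.zero = toℕ-injective (begin
  toℕ (cnext (fromℕ a))         ≡⟨ toℕ-cnext (fromℕ a) ⟩
  suc (toℕ (fromℕ a)) ℕ.% suc a ≡⟨ cong (λ n → suc n ℕ.% suc a) (toℕ-fromℕ a) ⟩
  suc a ℕ.% suc a               ≡⟨ n%n≡0 (suc a) ⟩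
  0                             ∎)
  where open ≡-Reasoning
cnext-cprev {a} (Fin.suc i) = toℕ-injective (begin
  toℕ (cnext (inject₁ i))         ≡⟨ toℕ-cnext (inject₁ i) ⟩
  suc (toℕ (inject₁ i)) ℕ.% suc a ≡⟨ cong (λ n → suc n ℕ.% suc a) (toℕ-inject₁ i) ⟩
  suc (toℕ i) ℕ.% suc a           ≡⟨ m<n⇒m%n≡m (s≤s (toℕ<n i)) ⟩
  suc (toℕ i)                     ∎)
  where open ≡-Reasoning

cprev-cnext : ∀ {a} (j : Fin (suc a)) → cprev (cnext j) ≡ j
cprev-cnext {a} j with ℕ.<-cmp (toℕ j) a
... | tri< j<a _ _ = toℕ-injective (after-successor (cnext j) (trans (toℕ-cnext j) (m<n⇒m%n≡m (s≤s j<a))))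
  where
  after-successor : ∀ k → toℕ k ≡ suc (toℕ j) → toℕ (cprev k) ≡ toℕ j
  after-successor (Fin.suc i) eq = trans (toℕ-inject₁ i) (ℕ.suc-injective eq)
... | tri≈ _ j≡a _ = toℕ-injective (after-last (cnext j) (begin
  toℕ (cnext j)         ≡⟨ toℕ-cnext j ⟩
  suc (toℕ j) ℕ.% suc a ≡⟨ cong (λ n → suc n ℕ.% suc a) j≡a ⟩
  suc a ℕ.% suc a       ≡⟨ n%n≡0 (suc a) ⟩
  0                     ∎))
  where
  open ≡-Reasoning
  after-last : ∀ k → toℕ k ≡ 0 → toℕ (cprev k) ≡ toℕ j
  after-last Fin.zero _ = trans (toℕ-fromℕ a) (sym j≡a)
... | tri> _ _ j>a = contradiction (ℕ.≤-pred (toℕ<n j)) (ℕ.<⇒≱ j>a)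

StrictMono-injective : ∀ {k m} {R : Fin k → Fin m} → StrictMono R →
                       ∀ {L L'} → toℕ (R L) ≡ toℕ (R L') → L ≡ L'
StrictMono-injective mono {L} {L'} eq with ℕ.<-cmp (toℕ L) (toℕ L')
... | tri< L<L' _ _ = contradiction eq (ℕ.<⇒≢ (mono L L' L<L'))
... | tri≈ _ L≡L' _ = toℕ-injective L≡L'
... | tri> _ _ L>L' = contradiction (sym eq) (ℕ.<⇒≢ (mono L' L L>L'))

-- R lists the positions of m rung ends along a cycle of length suc a, in increasing order.
module RungEnds {a m : ℕ} (R : Fin m → Fin (suc a)) (R-mono : StrictMono R) where

  Hit : ℕ → Set
  Hit n = ∃ λ L → toℕ (R L) ≡ n

  hit : ∀ n → Dec (Hit n)
  hit n = any? (λ L → toℕ (R L) ℕ.≟ n)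

  indicator : ∀ {n} → Dec (Hit n) → ℕ
  indicator (yes _) = 1
  indicator (no _)  = 0

  before : ℕ → ℕ
  before zero    = 0
  before (suc n) = indicator (hit n) ℕ.+ before n

  Threshold : ℕ → ℕ → Set
  Threshold n c = c ≤ m × (∀ L → toℕ L < c → toℕ (R L) < n) × (∀ L → c ≤ toℕ L → n ≤ toℕ (R L))

  hit-index : ∀ {n c} → Threshold n c → ∀ L → toℕ (R L) ≡ n → toℕ L ≡ c
  hit-index {n} {c} (_ , below , above) L RL≡n with ℕ.<-cmp (toℕ L) c
  ... | tri< L<c _ _ = contradiction RL≡n (ℕ.<⇒≢ (below L L<c))
  ... | tri≈ _ L≡c _ = L≡c
  ... | tri> _ _ L>c = contradiction (subst (toℕ (R L') <_) RL≡n (R-mono L' L (subst (_< toℕ L) c≡L' L>c)))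
                                     (ℕ.≤⇒≯ (above L' (ℕ.≤-reflexive c≡L')))
    where
    L' : Fin m
    L' = fromℕ< (ℕ.<-trans L>c (toℕ<n L))
    c≡L' : c ≡ toℕ L'
    c≡L' = sym (toℕ-fromℕ< (ℕ.<-trans L>c (toℕ<n L)))

  threshold : ∀ n → Threshold n (before n)
  threshold zero = z≤n , (λ _ ()) , (λ _ _ → z≤n)
  threshold (suc n) with threshold n | hit n
  ... | (c≤m , below , above) | no ¬hit =
    c≤m , (λ L L<c → ℕ.m≤n⇒m≤1+n (below L L<c)) ,
    (λ L c≤L → ℕ.≤∧≢⇒< (above L c≤L) (λ n≡RL → ¬hit (L , sym n≡RL)))
  ... | th@(c≤m , below , above) | yes (L₀ , RL₀≡n) = 1+c≤m , below' , above'
    where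
    L₀≡c : toℕ L₀ ≡ before n
    L₀≡c = hit-index th L₀ RL₀≡n
    1+c≤m : suc (before n) ≤ m
    1+c≤m = subst (_< m) L₀≡c (toℕ<n L₀)
    below' : ∀ L → toℕ L < suc (before n) → toℕ (R L) < suc n
    below' L L<1+c with ℕ.m≤n⇒m<n∨m≡n (ℕ.≤-pred L<1+c)
    ... | inj₁ L<c = ℕ.m≤n⇒m≤1+n (below L L<c)
    ... | inj₂ L≡c rewrite toℕ-injective {i = L} {j = L₀} (trans L≡c (sym L₀≡c)) =
      s≤s (ℕ.≤-reflexive RL₀≡n)
    above' : ∀ L → suc (before n) ≤ toℕ L → suc n ≤ toℕ (R L)
    above' L 1+c≤L =
      subst (λ r → suc r ≤ toℕ (R L)) RL₀≡n (R-mono L₀ L (subst (_< toℕ L) (sym L₀≡c) 1+c≤L))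

  before-all : before (suc a) ≡ m
  before-all with threshold (suc a)
  ... | c≤m , _ , above with ℕ.m≤n⇒m<n∨m≡n c≤m
  ...   | inj₂ c≡m = c≡m
  ...   | inj₁ c<m = contradiction (above L (ℕ.≤-reflexive (sym (toℕ-fromℕ< c<m)))) (ℕ.<⇒≱ (toℕ<n (R L)))
    where
    L : Fin m
    L = fromℕ< c<m

  -- the cycle edge from j to j + 1 lies after the first segment j rung ends
  segment : Fin (suc a) → ℕ
  segment j = before (suc (toℕ j))

  atHit : {A : Set} → (Fin m → A) → A → ∀ {n} → Dec (Hit n) → A
  atHit f d (yes (L , _)) = f L
  atHit f d (no _)        = d

  SegmentStep : (ℕ → ℤ) → Fin (suc a) → ∀ {n} → Dec (Hit n) → Set
  SegmentStep W j (yes (L , _)) = W (segment j) ≡ W (suc (toℕ L)) × W (segment (cprev j)) ≡ W (toℕ L)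
  SegmentStep W j (no _)        = W (segment j) ≡ W (segment (cprev j))

  segment-step : ∀ (W : ℕ → ℤ) → W m ≡ W 0 → ∀ j → SegmentStep W j (hit (toℕ j))
  segment-step W periodic Fin.zero = at-zero (hit 0) refl
    where
    last≡m : segment (cprev Fin.zero) ≡ m
    last≡m = trans (cong (λ n → before (suc n)) (toℕ-fromℕ a)) before-all
    at-zero : (d : Dec (Hit 0)) → hit 0 ≡ d → SegmentStep W Fin.zero d
    at-zero (yes (L , RL≡0)) hit≡d =
      trans (cong (λ d → W (indicator d ℕ.+ 0)) hit≡d) (cong (λ l → W (suc l)) (sym L≡0)) ,
      trans (cong W last≡m) (trans periodic (cong W (sym L≡0)))
      where
      L≡0 : toℕ L ≡ 0
      L≡0 = hit-index (threshold 0) L RL≡0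
    at-zero (no ¬hit) hit≡d =
      trans (cong (λ d → W (indicator d ℕ.+ 0)) hit≡d) (sym (trans (cong W last≡m) periodic))
  segment-step W periodic (Fin.suc i) = at-suc (hit (suc (toℕ i))) refl
    where
    n : ℕ
    n = suc (toℕ i)
    previous : segment (cprev (Fin.suc i)) ≡ before n
    previous = cong (λ l → before (suc l)) (toℕ-inject₁ i)
    at-suc : (d : Dec (Hit n)) → hit n ≡ d → SegmentStep W (Fin.suc i) d
    at-suc (yes (L , RL≡n)) hit≡d =
      trans (cong (λ d → W (indicator d ℕ.+ before n)) hit≡d) (cong (λ l → W (suc l)) (sym L≡c)) ,
      trans (cong W previous) (cong W (sym L≡c))
      where
      L≡c : toℕ L ≡ before n
      L≡c = hit-index (threshold n) L RL≡n
    at-suc (no ¬hit) hit≡d =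
      trans (cong (λ d → W (indicator d ℕ.+ before n)) hit≡d) (sym (cong W previous))

-- A cycle of a model graph through the edges edge j from vertex j to vertex (j + 1), with the
-- rung edges outRungs L and inRungs L leaving and entering it at position L.
record Rail (M : MGraph) : Set where
  field
    a m              : ℕ
    position         : Fin m → Fin (suc a)
    position-mono    : StrictMono position
    vertex           : Fin (suc a) → VM M
    edge             : Fin (suc a) → EM M
    edge-ends        : ∀ j → endsM M (edge j) ≡ (vertex j , vertex (cnext j))
    outRungs inRungs : Fin m → List (EM M)
    outRungs-unique  : ∀ L → Unique (outRungs L)
    inRungs-unique   : ∀ L → Unique (inRungs L)
    outRungs-leave   : ∀ L {x} → x ∈ outRungs L → Leaving M (vertex (position L)) x
    inRungs-enter    : ∀ L {x} → x ∈ inRungs L → Entering M (vertex (position L)) x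
    rungs-off-rail   : ∀ L j {x} → x ∈ outRungs L ⊎ x ∈ inRungs L → edge j ≢ x
    leaving          : ∀ j x → Leaving M (vertex j) x →
                       x ≡ edge j ⊎ ∃ λ L → position L ≡ j × x ∈ outRungs L
    entering         : ∀ j x → Entering M (vertex j) x →
                       x ≡ edge (cprev j) ⊎ ∃ λ L → position L ≡ j × x ∈ inRungs L

module _ {M : MGraph} (rail : Rail M) where

  open Rail rail
  open RungEnds position position-mono

  private
    atHit-∈ : ∀ (rungs : Fin m → List (EM M)) {j} (d : Dec (Hit (toℕ j))) {x} →
              x ∈ atHit rungs [] d → ∃ λ L → position L ≡ j × x ∈ rungs L
    atHit-∈ rungs (yes (L , PL≡j)) x∈ = L , toℕ-injective PL≡j , x∈

    ∈-atHit : ∀ (rungs : Fin m → List (EM M)) {j} (d : Dec (Hit (toℕ j))) {L x} →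
              position L ≡ j → x ∈ rungs L → x ∈ atHit rungs [] d
    ∈-atHit rungs (yes (L' , PL'≡j)) PL≡j x∈
      rewrite StrictMono-injective position-mono (trans PL'≡j (cong toℕ (sym PL≡j))) = x∈
    ∈-atHit rungs (no ¬hit) {L} PL≡j x∈ = contradiction (L , cong toℕ PL≡j) ¬hit

    atHit-unique : ∀ {i} (rungs : Fin m → List (EM M)) → (∀ L → Unique (rungs L)) →
                   (∀ L {x} → x ∈ rungs L → i ≢ x) → ∀ {n} (d : Dec (Hit n)) → Unique (i ∷ atHit rungs [] d)
    atHit-unique rungs unique off (yes (L , _)) = All.tabulate (off L) ∷ unique L
    atHit-unique rungs unique off (no _)        = All.[] ∷ []

  railOuts railIns : Fin (suc a) → List (EM M)
  railOuts j = edge j ∷ atHit outRungs [] (hit (toℕ j))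
  railIns  j = edge (cprev j) ∷ atHit inRungs [] (hit (toℕ j))

  railOuts-lists : ∀ j → Lists (Leaving M (vertex j)) (railOuts j)
  railOuts-lists j =
    atHit-unique outRungs outRungs-unique (λ L → rungs-off-rail L j ∘ inj₁) (hit (toℕ j)) , sound , complete
    where
    sound : ∀ {x} → x ∈ railOuts j → Leaving M (vertex j) x
    sound (here refl) = cong proj₁ (edge-ends j)
    sound (there x∈) =
      let L , PL≡j , x∈L = atHit-∈ outRungs (hit (toℕ j)) x∈ in trans (outRungs-leave L x∈L) (cong vertex PL≡j)
    complete : ∀ {x} → Leaving M (vertex j) x → x ∈ railOuts j
    complete {x} leaves with leaving j x leaves
    ... | inj₁ refl              = here refl
    ... | inj₂ (L , PL≡j , x∈L) = there (∈-atHit outRungs (hit (toℕ j)) PL≡j x∈L)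

  railIns-lists : ∀ j → Lists (Entering M (vertex j)) (railIns j)
  railIns-lists j =
    atHit-unique inRungs inRungs-unique (λ L → rungs-off-rail L (cprev j) ∘ inj₂) (hit (toℕ j)) , sound , complete
    where
    sound : ∀ {x} → x ∈ railIns j → Entering M (vertex j) x
    sound (here refl) = trans (cong proj₂ (edge-ends (cprev j))) (cong vertex (cnext-cprev j))
    sound (there x∈) =
      let L , PL≡j , x∈L = atHit-∈ inRungs (hit (toℕ j)) x∈ in trans (inRungs-enter L x∈L) (cong vertex PL≡j)
    complete : ∀ {x} → Entering M (vertex j) x → x ∈ railIns j
    complete {x} enters with entering j x enters
    ... | inj₁ refl              = here refl
    ... | inj₂ (L , PL≡j , x∈L) = there (∈-atHit inRungs (hit (toℕ j)) PL≡j x∈L)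

  -- W labels the m segments cyclically; each rung end absorbs the change of label across it.
  rail-balanced : ∀ h (W : ℕ → ℤ) → W m ≡ W 0 → (∀ j → h (edge j) ≡ W (segment j)) →
    (∀ L → W (suc (toℕ L)) + ∑ᴸ h (outRungs L) ≡ W (toℕ L) + ∑ᴸ h (inRungs L)) →
    ∀ j → BalancedAt M h (vertex j)
  rail-balanced h W periodic on-rail rung-balance j =
    railOuts j , railIns j , railOuts-lists j , railIns-lists j , balance (hit (toℕ j)) (segment-step W periodic j)
    where
    balance : ∀ d → SegmentStep W j d →
      h (edge j) + ∑ᴸ h (atHit outRungs [] d) ≡ h (edge (cprev j)) + ∑ᴸ h (atHit inRungs [] d)
    balance (yes (L , _)) (after , before) = begin
      h (edge j) + ∑ᴸ h (outRungs L)        ≡⟨ cong (_+ ∑ᴸ h (outRungs L)) (trans (on-rail j) after) ⟩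
      W (suc (toℕ L)) + ∑ᴸ h (outRungs L)   ≡⟨ rung-balance L ⟩
      W (toℕ L) + ∑ᴸ h (inRungs L)          ≡⟨ cong (_+ ∑ᴸ h (inRungs L)) (trans (on-rail (cprev j)) before) ⟨
      h (edge (cprev j)) + ∑ᴸ h (inRungs L) ∎
      where open ≡-Reasoning
    balance (no _) same = cong (_+ 0ℤ) (trans (on-rail j) (trans same (sym (on-rail (cprev j)))))

nz3? : ∀ z → Dec (NZ3 z)
nz3? z = ¬? (z ℤ.≟ 0ℤ) ×-dec (∣ z ∣ ℕ.<? 3)

value : Bool → ℤ
value b = if b then ℤ.+ 2 else ℤ.+ 1

rungValue : Bool → Bool → ℤ
rungValue b b' = value b - value b'

NZ3-value : ∀ b → NZ3 (value b)
NZ3-value true  = (λ ()) , s≤s (s≤s (s≤s z≤n))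
NZ3-value false = (λ ()) , s≤s (s≤s z≤n)

NZ3-±1 : ∀ {c} → NZ3 c → NZ3 (c + 1ℤ) ⊎ NZ3 (c + -1ℤ)
NZ3-±1 {ℤ.+ 0}                   (c≢0 , _) = contradiction refl c≢0
NZ3-±1 {ℤ.+ 1}                   _         = inj₁ (NZ3-value true)
NZ3-±1 {ℤ.+ 2}                   _         = inj₂ (NZ3-value false)
NZ3-±1 {ℤ.+ suc (suc (suc _))}   (_ , s≤s (s≤s (s≤s ())))
NZ3-±1 { ℤ.-[1+ 0 ] }            _         = inj₂ (NZ3-neg (NZ3-value true))
NZ3-±1 { ℤ.-[1+ 1 ] }            _         = inj₁ (NZ3-neg (NZ3-value false))
NZ3-±1 { ℤ.-[1+ suc (suc _) ] }  (_ , s≤s (s≤s (s≤s ())))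

NZ3-flip-choice : ∀ {c} → NZ3 c → ∀ b b' → NZ3 (c + rungValue b b') ⊎ NZ3 (c + rungValue (not b) (not b'))
NZ3-flip-choice nz3 true  true  = inj₁ (NZ3-+0ʳ refl nz3)
NZ3-flip-choice nz3 false false = inj₁ (NZ3-+0ʳ refl nz3)
NZ3-flip-choice nz3 true  false = NZ3-±1 nz3
NZ3-flip-choice nz3 false true  = swap (NZ3-±1 nz3)

rungValue-unflipped : ∀ b → rungValue b (b xor false) ≡ 0ℤ
rungValue-unflipped true  = refl
rungValue-unflipped false = refl

isZero : ℤ → Bool
isZero z = does (z ℤ.≟ 0ℤ)

-- A rung changes the label exactly when it carries no external value.
rung-NZ3 : ∀ b {z} → z ≡ 0ℤ ⊎ NZ3 z → NZ3 (z + rungValue b (b xor isZero z))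
rung-NZ3 b (inj₁ refl) = flipped b
  where
  flipped : ∀ b → NZ3 (0ℤ + rungValue b (b xor true))
  flipped true  = NZ3-value false
  flipped false = NZ3-neg (NZ3-value false)
rung-NZ3 b {z} (inj₂ nz3@(z≢0 , _)) with z ℤ.≟ 0ℤ
... | yes z≡0 = contradiction z≡0 z≢0
... | no  _   = NZ3-+0ʳ (rungValue-unflipped b) nz3

rung-absorbs : ∀ b b' → value b' + rungValue b b' ≡ value b + 0ℤ
rung-absorbs true  true  = refl
rung-absorbs true  false = refl
rung-absorbs false true  = refl
rung-absorbs false false = refl

rung-absorbs-negated : ∀ b b' → - value b' + 0ℤ ≡ - value b + rungValue b b'
rung-absorbs-negated true  true  = refl
rung-absorbs-negated true  false = refl
rung-absorbs-negated false true  = refl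
rung-absorbs-negated false false = refl

rung-absorbs-swapped : ∀ b b' → value (not b') + 0ℤ ≡ value (not b) + rungValue b b'
rung-absorbs-swapped true  true  = refl
rung-absorbs-swapped true  false = refl
rung-absorbs-swapped false true  = refl
rung-absorbs-swapped false false = refl

-- Segment l lies between rungs l - 1 and l; segment k is segment 0 again, read around the cycle.
record SegmentLabelling (k : ℕ) (i₀ : Fin k) (flips : Fin k → Bool) (twist : Bool) (c : ℤ) : Set where
  field
    label        : ℕ → Bool
    label-step   : ∀ l → l ≢ i₀ → label (suc (toℕ l)) ≡ label (toℕ l) xor flips l
    label-closes : label k ≡ twist xor label 0
    label-at-i₀  : NZ3 (c + rungValue (label (toℕ i₀)) (label (suc (toℕ i₀))))

module Labelling (k : ℕ) (i₀ : Fin k) (flips : Fin k → Bool) (twist : Bool) where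

  flipsℕ : ℕ → Bool
  flipsℕ l with l ℕ.<? k
  ... | yes l<k = flips (fromℕ< l<k)
  ... | no  _   = false

  flipsℕ-toℕ : ∀ l → flipsℕ (toℕ l) ≡ flips l
  flipsℕ-toℕ l with toℕ l ℕ.<? k
  ... | yes l<k = cong flips (fromℕ<-toℕ l l<k)
  ... | no  l≮k = contradiction (toℕ<n l) l≮k

  parity : ℕ → Bool
  parity zero    = false
  parity (suc c) = parity c xor flipsℕ c

  -- read forwards from segment 0 up to rung i₀, and backwards from segment k down to it
  base : ℕ → Bool
  base c with c ℕ.≤? toℕ i₀
  ... | yes _ = parity c
  ... | no  _ = (twist xor parity k) xor parity c

  base-step : ∀ l → l ≢ i₀ → base (suc (toℕ l)) ≡ base (toℕ l) xor flips l
  base-step l l≢i₀ with suc (toℕ l) ℕ.≤? toℕ i₀ | toℕ l ℕ.≤? toℕ i₀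
  ... | yes _   | yes _   = cong (parity (toℕ l) xor_) (flipsℕ-toℕ l)
  ... | yes l<i | no  l≰i = contradiction (ℕ.<⇒≤ l<i) l≰i
  ... | no  _   | no  _   = trans (cong (λ b → (twist xor parity k) xor (parity (toℕ l) xor b)) (flipsℕ-toℕ l))
                                  (sym (xor-assoc (twist xor parity k) (parity (toℕ l)) (flips l)))
  ... | no  l≮i | yes l≤i with ℕ.m≤n⇒m<n∨m≡n l≤i
  ...   | inj₁ l<i = contradiction l<i l≮i
  ...   | inj₂ l≡i = contradiction (toℕ-injective l≡i) l≢i₀

  base-0 : base 0 ≡ false
  base-0 with 0 ℕ.≤? toℕ i₀
  ... | yes _   = refl
  ... | no  0≰i = contradiction z≤n 0≰i

  base-k : base k ≡ twist
  base-k with k ℕ.≤? toℕ i₀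
  ... | yes k≤i = contradiction (toℕ<n i₀) (ℕ.≤⇒≯ k≤i)
  ... | no  _   = trans (xor-assoc twist (parity k) (parity k))
                        (trans (cong (twist xor_) (xor-same (parity k))) (xor-identityʳ twist))

  relabel : Bool → ℕ → Bool
  relabel negate c = negate xor base c

  relabel-step : ∀ negate l → l ≢ i₀ → relabel negate (suc (toℕ l)) ≡ relabel negate (toℕ l) xor flips l
  relabel-step negate l l≢i₀ =
    trans (cong (negate xor_) (base-step l l≢i₀)) (sym (xor-assoc negate (base (toℕ l)) (flips l)))

  relabel-closes : ∀ negate → relabel negate k ≡ twist xor relabel negate 0
  relabel-closes negate rewrite base-k | base-0 | xor-identityʳ negate = xor-comm negate twist

  segment-labelling : ∀ {c} → NZ3 c → SegmentLabelling k i₀ flips twist c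
  segment-labelling {c} nz3 with nz3? (c + rungValue (base (toℕ i₀)) (base (suc (toℕ i₀))))
  ... | yes admissible = record
    { label = relabel false ; label-step = relabel-step false ; label-closes = relabel-closes false
    ; label-at-i₀ = admissible }
  ... | no ¬admissible = record
    { label = relabel true ; label-step = relabel-step true ; label-closes = relabel-closes true
    ; label-at-i₀ = [ (λ admissible → contradiction admissible ¬admissible) , (λ negated → negated) ]′
                      (NZ3-flip-choice nz3 (base (toℕ i₀)) (base (suc (toℕ i₀)))) }

Correction : (M : MGraph) → (EM M → ℤ) → Set
Correction M ext = Σ (EM M → ℤ) λ h → IsBalanced M h × ∀ x → NZ3 (ext x + h x)

module Rungs {k : ℕ} (keep : Fin k → Bool) {Edge : Set} (rung : ∀ l → keep l ≡ true → Edge) where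

  rungsOf : Fin k → List Edge
  rungsOf l with keep l Bool.≟ true
  ... | yes q = rung l q ∷ []
  ... | no  _ = []

  rungsOf-∈ : ∀ l {x} → x ∈ rungsOf l → ∃ λ q → x ≡ rung l q
  rungsOf-∈ l x∈ with keep l Bool.≟ true | x∈
  ... | yes q | here x≡ = q , x≡

  ∈-rungsOf : ∀ l q → rung l q ∈ rungsOf l
  ∈-rungsOf l q with keep l Bool.≟ true
  ... | yes q' = here (cong (rung l) (≡-irrelevant q q'))
  ... | no  ¬q = contradiction q ¬q

  rungsOf-unique : ∀ l → Unique (rungsOf l)
  rungsOf-unique l with keep l Bool.≟ true
  ... | yes _ = [] ∷ []
  ... | no  _ = []

  ∑ᴸ-rungsOf : ∀ (h : Edge → ℤ) (f : Fin k → ℤ) → (∀ l q → h (rung l q) ≡ f l) →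
               (∀ l → keep l ≡ false → f l ≡ 0ℤ) → ∀ l → ∑ᴸ h (rungsOf l) ≡ f l
  ∑ᴸ-rungsOf h f kept deleted l with keep l Bool.≟ true
  ... | yes q = trans (ℤ.+-identityʳ (h (rung l q))) (kept l q)
  ... | no ¬q = sym (deleted l (¬-not ¬q))

  -- twist: whether the rails close up with the labels of the segments negated (Möbius ladder)
  module Labels (ext : Edge → ℤ) (twist : Bool)
                (i₀ : Fin k) (q₀ : keep i₀ ≡ true) (nz₀ : NZ3 (ext (rung i₀ q₀))) where

    flips : Fin k → Bool
    flips l with keep l Bool.≟ true
    ... | yes q = isZero (ext (rung l q))
    ... | no  _ = false

    flips-kept : ∀ l q → flips l ≡ isZero (ext (rung l q))
    flips-kept l q with keep l Bool.≟ true
    ... | yes q' = cong (λ q → isZero (ext (rung l q))) (≡-irrelevant q' q)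
    ... | no  ¬q = contradiction q ¬q

    flips-deleted : ∀ l → keep l ≡ false → flips l ≡ false
    flips-deleted l q with keep l Bool.≟ true
    ... | yes q' = contradiction (trans (sym q') q) λ ()
    ... | no  _  = refl

    open SegmentLabelling (Labelling.segment-labelling k i₀ flips twist nz₀) public

    labelBefore labelAfter : Fin k → Bool
    labelBefore l = label (toℕ l)
    labelAfter  l = label (suc (toℕ l))

    rungCorrection : Fin k → ℤ
    rungCorrection l = rungValue (labelBefore l) (labelAfter l)

    rungCorrection-deleted : ∀ l → keep l ≡ false → rungCorrection l ≡ 0ℤ
    rungCorrection-deleted l q = begin
      rungValue (labelBefore l) (labelAfter l)                ≡⟨ cong (rungValue (labelBefore l)) (label-step l l≢i₀) ⟩
      rungValue (labelBefore l) (labelBefore l xor flips l)   ≡⟨ cong (λ f → rungValue (labelBefore l) (labelBefore l xor f))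
                                                                      (flips-deleted l q) ⟩
      rungValue (labelBefore l) (labelBefore l xor false)     ≡⟨ rungValue-unflipped (labelBefore l) ⟩
      0ℤ                                                      ∎
      where
      open ≡-Reasoning
      l≢i₀ : l ≢ i₀
      l≢i₀ refl = contradiction (trans (sym q₀) q) λ ()

    rungCorrection-NZ3 : (∀ x → ext x ≡ 0ℤ ⊎ NZ3 (ext x)) → ∀ l q → NZ3 (ext (rung l q) + rungCorrection l)
    rungCorrection-NZ3 admissible l q with l Fin.≟ i₀
    ... | yes refl rewrite ≡-irrelevant q q₀ = label-at-i₀
    ... | no  l≢i₀ rewrite label-step l l≢i₀ | flips-kept l q = rung-NZ3 (labelBefore l) (admissible (rung l q))

module _ (p : CircParams) where

  open CircParams p

  private
    M : MGraph
    M = circModel p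

    rung : ∀ l → keep l ≡ true → EM M
    rung l q = inj₂ (inj₂ (l , q))

  open Rungs keep rung

  private
    top-off : ∀ l j {x} → x ∈ rungsOf l ⊎ x ∈ [] → inj₁ j ≢ x
    top-off l j (inj₁ x∈) eq with rungsOf-∈ l x∈
    ... | q , refl with () ← eq

    top-leaving : ∀ j x → Leaving M (inj₁ j) x → x ≡ inj₁ j ⊎ ∃ λ l → P l ≡ j × x ∈ rungsOf l
    top-leaving j (inj₁ j')              refl = inj₁ refl
    top-leaving j (inj₂ (inj₁ _))       ()
    top-leaving j (inj₂ (inj₂ (l , q))) refl = inj₂ (l , refl , ∈-rungsOf l q)

    top-entering : ∀ j x → Entering M (inj₁ j) x → x ≡ inj₁ (cprev j) ⊎ ∃ λ l → P l ≡ j × x ∈ []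
    top-entering j (inj₁ j') refl = inj₁ (cong inj₁ (sym (cprev-cnext j')))
    top-entering j (inj₂ (inj₁ _)) ()
    top-entering j (inj₂ (inj₂ _)) ()

    bottom-off : ∀ l j {x} → x ∈ [] ⊎ x ∈ rungsOf l → inj₂ (inj₁ j) ≢ x
    bottom-off l j (inj₂ x∈) eq with rungsOf-∈ l x∈
    ... | q , refl with () ← eq

    bottom-leaving : ∀ j x → Leaving M (inj₂ j) x → x ≡ inj₂ (inj₁ j) ⊎ ∃ λ l → Q l ≡ j × x ∈ []
    bottom-leaving j (inj₁ _)         ()
    bottom-leaving j (inj₂ (inj₁ j')) refl = inj₁ refl
    bottom-leaving j (inj₂ (inj₂ _))  ()

    bottom-entering : ∀ j x → Entering M (inj₂ j) x →
                      x ≡ inj₂ (inj₁ (cprev j)) ⊎ ∃ λ l → Q l ≡ j × x ∈ rungsOf l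
    bottom-entering j (inj₁ _)              ()
    bottom-entering j (inj₂ (inj₁ j'))      refl = inj₁ (cong (inj₂ ∘ inj₁) (sym (cprev-cnext j')))
    bottom-entering j (inj₂ (inj₂ (l , q))) refl = inj₂ (l , refl , ∈-rungsOf l q)

    top : Rail M
    top = record
      { a = a ; m = k ; position = P ; position-mono = monoP ; vertex = inj₁ ; edge = inj₁
      ; edge-ends = λ _ → refl ; outRungs = rungsOf ; inRungs = λ _ → []
      ; outRungs-unique = rungsOf-unique ; inRungs-unique = λ _ → []
      ; outRungs-leave = λ l x∈ → case rungsOf-∈ l x∈ of λ { (_ , refl) → refl }
      ; inRungs-enter = λ _ ()
      ; rungs-off-rail = top-off ; leaving = top-leaving ; entering = top-entering
      }

    bottom : Rail M
    bottom = record
      { a = b ; m = k ; position = Q ; position-mono = monoQ ; vertex = inj₂ ; edge = inj₂ ∘ inj₁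
      ; edge-ends = λ _ → refl ; outRungs = λ _ → [] ; inRungs = rungsOf
      ; outRungs-unique = λ _ → [] ; inRungs-unique = rungsOf-unique
      ; outRungs-leave = λ _ ()
      ; inRungs-enter = λ l x∈ → case rungsOf-∈ l x∈ of λ { (_ , refl) → refl }
      ; rungs-off-rail = bottom-off ; leaving = bottom-leaving ; entering = bottom-entering
      }

  circular-correction : ∀ (ext : EM M → ℤ) → (∀ x → ¬ isRung M x → ext x ≡ 0ℤ) →
                        (∀ x → ext x ≡ 0ℤ ⊎ NZ3 (ext x)) → ∀ i₀ q₀ → NZ3 (ext (rung i₀ q₀)) → Correction M ext
  circular-correction ext rails-free admissible i₀ q₀ nz₀ = h , balanced , nz3
    where
    open Labels ext false i₀ q₀ nz₀
    module Top    = RungEnds P monoP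
    module Bottom = RungEnds Q monoQ

    h : EM M → ℤ
    h (inj₁ j)              = value (label (Top.segment j))
    h (inj₂ (inj₁ j))       = - value (label (Bottom.segment j))
    h (inj₂ (inj₂ (l , _))) = rungCorrection l

    ∑-rungs : ∀ l → ∑ᴸ h (rungsOf l) ≡ rungCorrection l
    ∑-rungs = ∑ᴸ-rungsOf h rungCorrection (λ _ _ → refl) rungCorrection-deleted

    top-balance : ∀ l → value (labelAfter l) + ∑ᴸ h (rungsOf l) ≡ value (labelBefore l) + 0ℤ
    top-balance l = trans (cong (value (labelAfter l) +_) (∑-rungs l)) (rung-absorbs (labelBefore l) (labelAfter l))

    bottom-balance : ∀ l → - value (labelAfter l) + 0ℤ ≡ - value (labelBefore l) + ∑ᴸ h (rungsOf l)
    bottom-balance l =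
      trans (rung-absorbs-negated (labelBefore l) (labelAfter l)) (cong (- value (labelBefore l) +_) (sym (∑-rungs l)))

    balanced : IsBalanced M h
    balanced (inj₁ j) = rail-balanced top h (value ∘ label) (cong value label-closes) (λ _ → refl) top-balance j
    balanced (inj₂ j) =
      rail-balanced bottom h (-_ ∘ value ∘ label) (cong (-_ ∘ value) label-closes) (λ _ → refl) bottom-balance j

    nz3 : ∀ x → NZ3 (ext x + h x)
    nz3 (inj₁ j)              = NZ3-+0 (rails-free (inj₁ j) λ ()) (NZ3-value _)
    nz3 (inj₂ (inj₁ j))       = NZ3-+0 (rails-free (inj₂ (inj₁ j)) λ ()) (NZ3-neg (NZ3-value _))
    nz3 (inj₂ (inj₂ (l , q))) = rungCorrection-NZ3 admissible l q

module _ (p : MobParams) where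

  open MobParams p

  private
    M : MGraph
    M = mobModel p

    rung : ∀ l → keep l ≡ true → EM M
    rung l q = inj₂ (l , q)

  open Rungs keep rung

  private
    -- rung ends in cyclic order: first the ends P l, then the ends Q l
    end : Fin k ⊎ Fin k → Fin (suc a)
    end = [ P , Q ]′

    position : Fin (k ℕ.+ k) → Fin (suc a)
    position L = end (splitAt k {k} L)

    toℕ-left : ∀ {L l} → splitAt k {k} L ≡ inj₁ l → toℕ L ≡ toℕ l
    toℕ-left {L} {l} eq = trans (cong toℕ (sym (splitAt⁻¹-↑ˡ eq))) (toℕ-↑ˡ l k)

    toℕ-right : ∀ {L l} → splitAt k {k} L ≡ inj₂ l → toℕ L ≡ k ℕ.+ toℕ l
    toℕ-right {L} {l} eq = trans (cong toℕ (sym (splitAt⁻¹-↑ʳ eq))) (toℕ-↑ʳ k l)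

    position-mono : StrictMono position
    position-mono L₁ L₂ L₁<L₂ with splitAt k {k} L₁ in eq₁ | splitAt k {k} L₂ in eq₂
    ... | inj₁ l₁ | inj₁ l₂ = monoP l₁ l₂ (subst₂ _<_ (toℕ-left eq₁) (toℕ-left eq₂) L₁<L₂)
    ... | inj₁ l₁ | inj₂ l₂ = P<Q l₁ l₂
    ... | inj₂ l₁ | inj₁ l₂ = contradiction (subst₂ _<_ (toℕ-right eq₁) (toℕ-left eq₂) L₁<L₂)
                                (ℕ.≤⇒≯ (ℕ.≤-trans (ℕ.<⇒≤ (toℕ<n l₂)) (ℕ.m≤m+n k (toℕ l₁))))
    ... | inj₂ l₁ | inj₂ l₂ =
      monoQ l₁ l₂ (ℕ.+-cancelˡ-< k _ _ (subst₂ _<_ (toℕ-right eq₁) (toℕ-right eq₂) L₁<L₂))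

    outRungs inRungs : Fin (k ℕ.+ k) → List (EM M)
    outRungs L = [ rungsOf , (λ _ → []) ]′ (splitAt k {k} L)
    inRungs  L = [ (λ _ → []) , rungsOf ]′ (splitAt k {k} L)

    rungs-∈ : ∀ L {x} → x ∈ outRungs L ⊎ x ∈ inRungs L → ∃ λ l → ∃ λ q → x ≡ rung l q
    rungs-∈ L x∈ with splitAt k {k} L | x∈
    ... | inj₁ l | inj₁ x∈l = l , rungsOf-∈ l x∈l
    ... | inj₂ l | inj₂ x∈l = l , rungsOf-∈ l x∈l

    outRungs-leave : ∀ L {x} → x ∈ outRungs L → Leaving M (position L) x
    outRungs-leave L x∈ with splitAt k {k} L | x∈
    ... | inj₁ l | x∈l = case rungsOf-∈ l x∈l of λ { (_ , refl) → refl }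

    inRungs-enter : ∀ L {x} → x ∈ inRungs L → Entering M (position L) x
    inRungs-enter L x∈ with splitAt k {k} L | x∈
    ... | inj₂ l | x∈l = case rungsOf-∈ l x∈l of λ { (_ , refl) → refl }

    leaving : ∀ j x → Leaving M j x → x ≡ inj₁ j ⊎ ∃ λ L → position L ≡ j × x ∈ outRungs L
    leaving j (inj₁ j')     refl = inj₁ refl
    leaving j (inj₂ (l , q)) refl = inj₂ (l ↑ˡ k , cong end (splitAt-↑ˡ k l k) ,
      subst (λ e → rung l q ∈ [ rungsOf , (λ _ → []) ]′ e) (sym (splitAt-↑ˡ k l k)) (∈-rungsOf l q))

    entering : ∀ j x → Entering M j x → x ≡ inj₁ (cprev j) ⊎ ∃ λ L → position L ≡ j × x ∈ inRungs L
    entering j (inj₁ j')     refl = inj₁ (cong inj₁ (sym (cprev-cnext j')))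
    entering j (inj₂ (l , q)) refl = inj₂ (k ↑ʳ l , cong end (splitAt-↑ʳ k k l) ,
      subst (λ e → rung l q ∈ [ (λ _ → []) , rungsOf ]′ e) (sym (splitAt-↑ʳ k k l)) (∈-rungsOf l q))

    outRungs-unique : ∀ L → Unique (outRungs L)
    outRungs-unique L with splitAt k {k} L
    ... | inj₁ l = rungsOf-unique l
    ... | inj₂ _ = []

    inRungs-unique : ∀ L → Unique (inRungs L)
    inRungs-unique L with splitAt k {k} L
    ... | inj₁ _ = []
    ... | inj₂ l = rungsOf-unique l

    rail : Rail M
    rail = record
      { a = a ; m = k ℕ.+ k ; position = position ; position-mono = position-mono ; vertex = λ j → j ; edge = inj₁
      ; edge-ends = λ _ → refl ; outRungs = outRungs ; inRungs = inRungs
      ; outRungs-unique = outRungs-unique ; inRungs-unique = inRungs-unique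
      ; outRungs-leave = outRungs-leave ; inRungs-enter = inRungs-enter
      ; rungs-off-rail = λ L j x∈ → case rungs-∈ L x∈ of λ { (_ , _ , refl) () }
      ; leaving = leaving ; entering = entering
      }

  möbius-correction : ∀ (ext : EM M → ℤ) → (∀ x → ¬ isRung M x → ext x ≡ 0ℤ) →
                      (∀ x → ext x ≡ 0ℤ ⊎ NZ3 (ext x)) → ∀ i₀ q₀ → NZ3 (ext (rung i₀ q₀)) → Correction M ext
  möbius-correction ext rails-free admissible i₀ q₀ nz₀ = h , balanced , nz3
    where
    open Labels ext true i₀ q₀ nz₀
    open RungEnds position position-mono using (segment)

    -- after the k-th rung end the rail is traversed a second time, with the labels swapped
    W : ℕ → ℤ
    W c with c ℕ.≤? k
    ... | yes _ = value (label c)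
    ... | no  _ = value (not (label (c ∸ k)))

    W-first : ∀ {c} → c ≤ k → W c ≡ value (label c)
    W-first {c} c≤k with c ℕ.≤? k
    ... | yes _   = refl
    ... | no  c≰k = contradiction c≤k c≰k

    W-second : ∀ l → W (k ℕ.+ l) ≡ value (not (label l))
    W-second zero rewrite ℕ.+-identityʳ k = trans (W-first ℕ.≤-refl) (cong value label-closes)
    W-second (suc l) with k ℕ.+ suc l ℕ.≤? k
    ... | yes k+l≤k = contradiction k+l≤k (ℕ.<⇒≱ (ℕ.m<m+n k (s≤s z≤n)))
    ... | no  _     = cong (λ c → value (not (label c))) (ℕ.m+n∸m≡n k (suc l))

    W-periodic : W (k ℕ.+ k) ≡ W 0
    W-periodic = trans (W-second k) (trans (cong (λ b → value (not b)) label-closes)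
                       (trans (cong value (not-involutive (label 0))) (sym (W-first z≤n))))

    W-NZ3 : ∀ c → NZ3 (W c)
    W-NZ3 c with c ℕ.≤? k
    ... | yes _ = NZ3-value _
    ... | no  _ = NZ3-value _

    h : EM M → ℤ
    h (inj₁ j)       = W (segment j)
    h (inj₂ (l , _)) = rungCorrection l

    ∑-rungs : ∀ l → ∑ᴸ h (rungsOf l) ≡ rungCorrection l
    ∑-rungs = ∑ᴸ-rungsOf h rungCorrection (λ _ _ → refl) rungCorrection-deleted

    rung-balance : ∀ L → W (suc (toℕ L)) + ∑ᴸ h (outRungs L) ≡ W (toℕ L) + ∑ᴸ h (inRungs L)
    rung-balance L with splitAt k {k} L in eq
    ... | inj₁ l = begin
      W (suc (toℕ L)) + ∑ᴸ h (rungsOf l)        ≡⟨ cong₂ _+_ (trans (cong (W ∘ suc) L≡l) (W-first (toℕ<n l))) (∑-rungs l) ⟩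
      value (labelAfter l) + rungCorrection l   ≡⟨ rung-absorbs (labelBefore l) (labelAfter l) ⟩
      value (labelBefore l) + 0ℤ                ≡⟨ cong (_+ 0ℤ) (trans (cong W L≡l) (W-first (ℕ.<⇒≤ (toℕ<n l)))) ⟨
      W (toℕ L) + 0ℤ                            ∎
      where
      open ≡-Reasoning
      L≡l : toℕ L ≡ toℕ l
      L≡l = toℕ-left eq
    ... | inj₂ l = begin
      W (suc (toℕ L)) + 0ℤ                          ≡⟨ cong (λ c → W c + 0ℤ) 1+L≡k+1+l ⟩
      W (k ℕ.+ suc (toℕ l)) + 0ℤ                    ≡⟨ cong (_+ 0ℤ) (W-second (suc (toℕ l))) ⟩
      value (not (labelAfter l)) + 0ℤ               ≡⟨ rung-absorbs-swapped (labelBefore l) (labelAfter l) ⟩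
      value (not (labelBefore l)) + rungCorrection l ≡⟨ cong₂ _+_ (trans (cong W L≡k+l) (W-second (toℕ l))) (∑-rungs l) ⟨
      W (toℕ L) + ∑ᴸ h (rungsOf l)                  ∎
      where
      open ≡-Reasoning
      L≡k+l : toℕ L ≡ k ℕ.+ toℕ l
      L≡k+l = toℕ-right eq
      1+L≡k+1+l : suc (toℕ L) ≡ k ℕ.+ suc (toℕ l)
      1+L≡k+1+l = trans (cong suc L≡k+l) (sym (ℕ.+-suc k (toℕ l)))

    balanced : IsBalanced M h
    balanced = rail-balanced rail h W W-periodic (λ _ → refl) rung-balance

    nz3 : ∀ x → NZ3 (ext x + h x)
    nz3 (inj₁ j)       = NZ3-+0 (rails-free (inj₁ j) λ ()) (W-NZ3 (segment j))
    nz3 (inj₂ (l , q)) = rungCorrection-NZ3 admissible l q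

ladder-correction : ∀ (lp : LadderParams) (ext : EM (ladderModel lp) → ℤ) →
  (∀ x → ¬ isRung (ladderModel lp) x → ext x ≡ 0ℤ) → (∀ x → ext x ≡ 0ℤ ⊎ NZ3 (ext x)) →
  (∃ λ x → NZ3 (ext x)) → Correction (ladderModel lp) ext
ladder-correction (inj₁ p) ext rails-free admissible (inj₂ (inj₂ (i₀ , q₀)) , nz₀) =
  circular-correction p ext rails-free admissible i₀ q₀ nz₀
ladder-correction (inj₂ p) ext rails-free admissible (inj₂ (i₀ , q₀) , nz₀) =
  möbius-correction p ext rails-free admissible i₀ q₀ nz₀
ladder-correction (inj₁ p) ext rails-free _ (x@(inj₁ _) , nz)        = contradiction (rails-free x λ ()) (proj₁ nz)
ladder-correction (inj₁ p) ext rails-free _ (x@(inj₂ (inj₁ _)) , nz) = contradiction (rails-free x λ ()) (proj₁ nz)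
ladder-correction (inj₂ p) ext rails-free _ (x@(inj₁ _) , nz)        = contradiction (rails-free x λ ()) (proj₁ nz)

module _ {Γ : Graph} (Λ Θ : Subgraph Γ) {ψ : Fin (nE Γ) → ℤ}
         (ψ-supported : SupportedOn Λ ψ) (ψ-nz3 : ∀ e → es Λ e ≡ true → NZ3 (ψ e)) where

  disjoint-corrects : (∀ e → ¬ CommonEdge Θ Λ e) → AdmitsNZFlow 3 Θ → Σ (Fin (nE Γ) → ℤ) (Corrects ψ Θ)
  disjoint-corrects disjoint Θ-flow with circulation-of-flow Θ Θ-flow
  ... | φ , φ-circulation , φ-supported , φ-nz3 = φ , φ-circulation , φ-supported , values
    where
    values : ∀ e → es Θ e ≡ true → NZ3 (ψ e + φ e)
    values e e∈Θ with es Λ e in e∈Λ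
    ... | true  = contradiction (∧-true⁺ e∈Θ e∈Λ) (disjoint e)
    ... | false = NZ3-+0 (ψ-supported e e∈Λ) (φ-nz3 e e∈Θ)

  ladder-sharing-corrects : (L : ClosedLadderStr Θ) → (∀ e → CommonEdge Θ Λ e → IsRungOf L e) →
                            ∀ e₀ → CommonEdge Θ Λ e₀ → Σ (Fin (nE Γ) → ℤ) (Corrects ψ Θ)
  ladder-sharing-corrects L shared-rungs e₀ shared₀ =
    let h , balanced , nz3 = ladder-correction (params L) ext rails-free admissible shared-value
    in  transport h , transport-corrects ψ h balanced nz3
    where
    I : Iso (ladderModel (params L)) Θ
    I = iso L
    open Transfer I

    ext : EM (ladderModel (params L)) → ℤ
    ext x = sign x (ψ (g I x))

    rails-free : ∀ x → ¬ isRung (ladderModel (params L)) x → ext x ≡ 0ℤ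
    rails-free x ¬rung with es Λ (g I x) in gx∈Λ
    ... | true with shared-rungs (g I x) (∧-true⁺ (g-into I x) gx∈Λ)
    ...   | x' , rung , gx'≡gx rewrite g-inj I x' x gx'≡gx = contradiction rung ¬rung
    rails-free x ¬rung | false = trans (cong (sign x) (ψ-supported (g I x) gx∈Λ)) (sign-zero x)

    admissible : ∀ x → ext x ≡ 0ℤ ⊎ NZ3 (ext x)
    admissible x with es Λ (g I x) in gx∈Λ
    ... | true  = inj₂ (sign-NZ3 x (ψ-nz3 (g I x) gx∈Λ))
    ... | false = inj₁ (trans (cong (sign x) (ψ-supported (g I x) gx∈Λ)) (sign-zero x))

    shared-value : ∃ λ x → NZ3 (ext x)
    shared-value with ∧-true⁻ shared₀
    ... | e₀∈Θ , e₀∈Λ with g-onto I e₀ e₀∈Θ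
    ...   | x₀ , refl = x₀ , sign-NZ3 x₀ (ψ-nz3 (g I x₀) e₀∈Λ)

  ladder-corrects : (L : ClosedLadderStr Θ) → ((∀ e → ¬ CommonEdge Θ Λ e) → AdmitsNZFlow 3 Θ) →
                    (∀ e → CommonEdge Θ Λ e → IsRungOf L e) → Σ (Fin (nE Γ) → ℤ) (Corrects ψ Θ)
  ladder-corrects L own-flow shared-rungs with any? (λ e → (es Θ e ∧ es Λ e) Bool.≟ true)
  ... | yes (e₀ , shared₀) = ladder-sharing-corrects L shared-rungs e₀ shared₀
  ... | no  ¬shared        = disjoint-corrects disjoint (own-flow disjoint)
    where
    disjoint : ∀ e → ¬ CommonEdge Θ Λ e
    disjoint e shared = ¬shared (e , shared)

theorem3p3 : (Γ : Graph) (Λ Σ' : Subgraph Γ) →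
    IsUnion Γ Λ Σ' →
    AdmitsNZFlow 3 Λ →
    ((Θ : Subgraph Γ) → IsComponent Σ' Θ →
    Σ (ClosedLadderStr Θ) λ L →
    ((∀ e → ¬ CommonEdge Θ Λ e) → AdmitsNZFlow 3 Θ) ×
    (∀ e → CommonEdge Θ Λ e → IsRungOf L e)) →
    AdmitsNZFlow 3 (whole Γ)
theorem3p3 Γ Λ Σ' (_ , covered) Λ-flow ladders
  with circulation-of-flow Λ Λ-flow
... | ψ , ψ-circulation , ψ-supported , ψ-nz3
  with Reachability.component-corrections Σ' {ψ} (λ r r∈Σ' →
         let L , own-flow , shared-rungs = ladders _ (Reachability.component-isComponent Σ' r r∈Σ')
         in  ladder-corrects Λ _ ψ-supported ψ-nz3 L own-flow shared-rungs)
... | φ , φ-circulation , φ-supported , φ-nz3 =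
  flow-of-circulation Γ (circulation-+ Γ ψ-circulation φ-circulation) values
  where
  values : ∀ e → NZ3 (ψ e + φ e)
  values e with true-or-false (es Σ' e) | ∨-true⁻ (covered e)
  ... | inj₁ e∈Σ' | _         = φ-nz3 e e∈Σ'
  ... | inj₂ e∉Σ' | inj₁ e∈Λ  = NZ3-+0ʳ (φ-supported e e∉Σ') (ψ-nz3 e e∈Λ)
  ... | inj₂ e∉Σ' | inj₂ e∈Σ' = contradiction (trans (sym e∈Σ') e∉Σ') λ ()
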